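{- Consider the following graph on the set of all partitions (ranked by size). Up edges: one edge from $\lambda$ to $\mu$ whenever $\mu$ is obtained from $\lambda$ by adding one box, plus, at each partition $\lambda$, a number of loops equal to the number of inner corners of $\lambda$. Down edges: one edge from $\nu$ down to $\lambda$ whenever $\lambda\subsetneq\nu$ and $\nu/\lambda$ is a rook strip (no two boxes of $\nu/\lambda$ lie in the same row or the same column). Then the associated up and down operators satisfy $DU-UD=D+I$, so this graph is a dual filtered graph.
   Context: An inner corner of a partition $\lambda$ is a box whose removal leaves a partition. For a graph with up-edge multiplicities $a_1(x,y)$ (edge from $x$ up to $y$, loops allowed) and down-edge multiplicities $a_2(x,y)$ (edge from $y$ down to $x$), the operators on formal linear combinations of vertices are $Ux=\sum_y a_1(x,y)y$ and $Dy=\sum_x a_2(x,y)x$. This graph is the "Möbius deformation" of Young's lattice: the down-edge multiplicity from $\nu$ to $\lambda$ equals $|\mu(\lambda,\nu)|$ for the Möbius function $\mu$ of Young's lattice, and the number of loops at $\lambda$ equals the number of partitions covered by $\lambda$. -}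

module Defs where

open import Data.Bool using (Bool; true; false; _∧_; _∨_; not; if_then_else_)
open import Data.Nat using (ℕ; zero; suc; _≤_; _≥_; _≡ᵇ_; _≤ᵇ_)
open import Data.Nat.Properties using (_≥?_; _≤?_)
open import Data.Integer using (ℤ; +_; -_) renaming (_+_ to _+ℤ_; _*_ to _*ℤ_)
open import Data.List using (List; []; _∷_; map; concat; concatMap; upTo; length; filter; _++_; mapMaybe; foldr)
open import Data.Nat.ListAction using (sum)
open import Data.Bool.ListAction using (all; any)
open import Data.List.Relation.Unary.All using (All; all?)
open import Data.List.Relation.Unary.Linked using (Linked; linked?)
open import Data.Maybe using (Maybe; just; nothing)
open import Data.Product using (_×_; _,_; proj₁; proj₂)
open import Relation.Nullary using (yes; no)
open import Relation.Binary.PropositionalEquality using (_≡_)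

record Partition : Set where
  constructor mkPartition
  field
    parts    : List ℕ
    weakDec  : Linked _≥_ parts
    positive : All (1 ≤_) parts
open Partition public

size : Partition → ℕ
size la = sum (parts la)

eqList : List ℕ → List ℕ → Bool
eqList []       []       = true
eqList (a ∷ as) (b ∷ bs) = (a ≡ᵇ b) ∧ eqList as bs
eqList _        _        = false

samePartition : Partition → Partition → Bool
samePartition la mu = eqList (parts la) (parts mu)

-- Young diagrams as lists of boxes (row i, column j), 0-indexed:
-- box (i , j) belongs to λ iff j < λ_i.

Box : Set
Box = ℕ × ℕ

eqBox : Box → Box → Bool
eqBox (i , j) (i' , j') = (i ≡ᵇ i') ∧ (j ≡ᵇ j')

_∈ᵇ_ : Box → List Box → Bool
b ∈ᵇ S = any (eqBox b) S

diagramFrom : ℕ → List ℕ → List Box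
diagramFrom i []       = []
diagramFrom i (k ∷ ks) = map (i ,_) (upTo k) ++ diagramFrom (suc i) ks

diagram : Partition → List Box
diagram la = diagramFrom 0 (parts la)

-- a finite set of boxes is the diagram of a partition iff it is
-- closed under moving up and moving left
isDownClosed : List Box → Bool
isDownClosed S = all ok S
  where
  ok : Box → Bool
  ok (i , j) = up i j ∧ left i j
    where
    up : ℕ → ℕ → Bool
    up zero    j = true
    up (suc i) j = (i , j) ∈ᵇ S
    left : ℕ → ℕ → Bool
    left i zero    = true
    left i (suc j) = (i , j) ∈ᵇ S

removeBox : Box → List Box → List Box
removeBox b = filter (λ c → Data.Bool.T? (not (eqBox b c)))
  where import Data.Bool

innerCorners : Partition → List Box
innerCorners la = filter (λ b → Data.Bool.T? (isDownClosed (removeBox b (diagram la)))) (diagram la)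
  where import Data.Bool

numInnerCorners : Partition → ℕ
numInnerCorners la = length (innerCorners la)

_⊆ᵇ_ : Partition → Partition → Bool
la ⊆ᵇ nu = all (_∈ᵇ diagram nu) (diagram la)

skew : Partition → Partition → List Box
skew nu la = filter (λ b → Data.Bool.T? (not (b ∈ᵇ diagram la))) (diagram nu)
  where import Data.Bool

_⊊ᵇ_ : Partition → Partition → Bool
la ⊊ᵇ nu = (la ⊆ᵇ nu) ∧ not (samePartition la nu)

addsOneBox : Partition → Partition → Bool
addsOneBox la mu = (la ⊆ᵇ mu) ∧ (length (skew mu la) ≡ᵇ 1)

noDup : List ℕ → Bool
noDup []       = true
noDup (x ∷ xs) = not (any (x ≡ᵇ_) xs) ∧ noDup xs

isRookStrip : List Box → Bool
isRookStrip S = noDup (map proj₁ S) ∧ noDup (map proj₂ S)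

a₁ : Partition → Partition → ℕ
a₁ x y = (if addsOneBox x y then 1 else 0)
       Data.Nat.+ (if samePartition x y then numInnerCorners x else 0)

-- a₂ x y : down edges from y down to x
a₂ : Partition → Partition → ℕ
a₂ x y = if (x ⊊ᵇ y) ∧ isRookStrip (skew y x) then 1 else 0

listsUpTo : ℕ → ℕ → List (List ℕ)
listsUpTo b zero    = [] ∷ []
listsUpTo b (suc L) = [] ∷ concatMap (λ k → map (k ∷_) (listsUpTo b L)) (upTo (suc b))

toPartition : List ℕ → Maybe Partition
toPartition ks with linked? _≥?_ ks | all? (1 ≤?_) ks
... | yes d | yes p = just (mkPartition ks d p)
... | _     | _     = nothing

partitionsUpTo : ℕ → List Partition
partitionsUpTo N =
  filter (λ p → size p ≤? N) (mapMaybe toPartition (listsUpTo N N))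

LinComb : Set
LinComb = List (ℤ × Partition)

coeff : Partition → LinComb → ℤ
coeff ρ = foldr (λ { (c , x) acc → (if samePartition ρ x then c else + 0) +ℤ acc }) (+ 0)

_≈_ : LinComb → LinComb → Set
v ≈ w = ∀ ρ → coeff ρ v ≡ coeff ρ w

_⊕_ : LinComb → LinComb → LinComb
v ⊕ w = v ++ w

⊖_ : LinComb → LinComb
⊖ v = map (λ { (c , x) → (- c , x) }) v

linExt : (Partition → LinComb) → LinComb → LinComb
linExt f = concatMap (λ { (c , x) → map (λ { (d , y) → (c *ℤ d , y) }) (f x) })

-- U x = Σ_y a₁(x,y) y ,  D y = Σ_x a₂(x,y) x .
-- (a₁ x y ≠ 0 forces size y ≤ size x + 1 and a₂ x y ≠ 0 forces
--  size x < size y, so the sums range over partitions of size ≤ size + 1.)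
Uᵥ : Partition → LinComb
Uᵥ x = map (λ y → (+ a₁ x y , y)) (partitionsUpTo (suc (size x)))

Dᵥ : Partition → LinComb
Dᵥ y = map (λ x → (+ a₂ x y , x)) (partitionsUpTo (suc (size y)))

U : LinComb → LinComb
U = linExt Uᵥ

D : LinComb → LinComb
D = linExt Dᵥ

-- Write R for the rook-strip relation, R(λ, ν) = 1 iff ν/λ is a rook strip or empty; its matrix is D + I, since
-- the down edges are exactly the nonempty rook strips. The up operator sends x to its covers in Young's lattice
-- plus c(x) loops, where c counts inner corners, i.e. distinct parts. The coefficient of ρ in (DU − UD) x then
-- reduces, after cancelling the cover relation (ρ covers x) occurring on both sides, to the identity
--   Σ_{y covers x} R(ρ, y) + c(x) R(ρ, x) = Σ_{ρ covers z} R(z, x) + c(ρ) R(ρ, x) + R(ρ, x),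
-- the coefficient form of D′U − UD′ = D′ for D′ = D + I. It is proved by induction on the parts of ρ and x,
-- comparing their first parts: the rook condition is local to consecutive rows, and the covers of x are obtained by
-- growing its first row or by covering its remaining rows. Linear combinations are compared coefficientwise, and
-- partitionsUpTo N lists every partition of size at most N exactly once, so the sums defining U and D reduce to
-- sums over the covers and the loops.

module Submission where

open import Defs
open import Data.Bool using (Bool; true; false; _∧_; _∨_; not; if_then_else_; T)
open import Data.Bool.Properties as BP using ()
open import Data.Bool.ListAction using (all; any)
open import Data.Empty using (⊥-elim)
open import Data.Integer using (ℤ; -_) renaming (_+_ to _+ℤ_; _*_ to _*ℤ_)
open import Data.Integer.Properties as ℤP using ()
open import Data.Integer.Tactic.RingSolver using (solve-∀)
open import Data.List using (List; []; _∷_; map; upTo; length; filter; filterᵇ; _++_; null; concatMap; mapMaybe)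
open import Data.List.Properties using (map-++; map-∘; map-id; length-++; length-map; upTo-∷ʳ; filter-++; ++-identityʳ)
open import Data.List.Relation.Unary.All as All using (All; []; _∷_; all?)
open import Data.List.Relation.Unary.All.Properties using (++⁺; map⁺; filter⁺; all-upTo)
open import Data.List.Relation.Unary.Linked as Linked using (Linked; []; [-]; _∷_; linked?)
import Data.Integer as ℤ
import Data.Nat as ℕ
open import Data.Nat using (ℕ; zero; suc; _+_; _*_; _∸_; _≤_; _<_; _≥_; _≡ᵇ_; _≤ᵇ_; _<ᵇ_; z≤n; s≤s)
open import Data.Nat.ListAction using (sum)
open import Data.Nat.Properties as ℕP using (_≤?_; _<?_; _≥?_; <-cmp)
import Data.Nat.Tactic.RingSolver as ℕ-Solver
open import Algebra.Properties.CommutativeSemigroup ℕP.+-commutativeSemigroup using () renaming (interchange to +-interchange)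
open import Data.Product using (_×_; _,_; proj₁; proj₂)
open import Data.Sum using (_⊎_; inj₁; inj₂; map₂)
open import Relation.Binary.Definitions using (tri<; tri≈; tri>)
open import Relation.Binary.PropositionalEquality
open import Relation.Nullary using (¬_; yes; no; T?)

ι : Bool → ℕ
ι b = if b then 1 else 0

ι-∧ : ∀ a b → ι (a ∧ b) ≡ ι a * ι b
ι-∧ true  b = sym (ℕP.+-identityʳ (ι b))
ι-∧ false b = refl

∧-trueˡ : ∀ {a b} → (a ∧ b) ≡ true → a ≡ true
∧-trueˡ {true} _ = refl

∧-trueʳ : ∀ {a b} → (a ∧ b) ≡ true → b ≡ true
∧-trueʳ {true} e = e

≡ᵇ-sound : ∀ m n → (m ≡ᵇ n) ≡ true → m ≡ n
≡ᵇ-sound m n e = ℕP.≡ᵇ⇒≡ m n (subst T (sym e) _)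

≡ᵇ-refl : ∀ n → (n ≡ᵇ n) ≡ true
≡ᵇ-refl zero    = refl
≡ᵇ-refl (suc n) = ≡ᵇ-refl n

≢⇒≡ᵇ-false : ∀ m n → m ≢ n → (m ≡ᵇ n) ≡ false
≢⇒≡ᵇ-false m n m≢n with m ≡ᵇ n in e
... | true  = ⊥-elim (m≢n (≡ᵇ-sound m n e))
... | false = refl

<⇒≡ᵇ-false : ∀ {m n} → m < n → (m ≡ᵇ n) ≡ false
<⇒≡ᵇ-false {m} {n} m<n = ≢⇒≡ᵇ-false m n (ℕP.<⇒≢ m<n)

>⇒≡ᵇ-false : ∀ {m n} → n < m → (m ≡ᵇ n) ≡ false
>⇒≡ᵇ-false {m} {n} n<m = ≢⇒≡ᵇ-false m n (ℕP.>⇒≢ n<m)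

≤ᵇ-sound : ∀ m n → (m ≤ᵇ n) ≡ true → m ≤ n
≤ᵇ-sound m n e = ℕP.≤ᵇ⇒≤ m n (subst T (sym e) _)

≤ᵇ-complete : ∀ {m n} → m ≤ n → (m ≤ᵇ n) ≡ true
≤ᵇ-complete {m} {n} m≤n with m ≤ᵇ n in e
... | true  = refl
... | false = ⊥-elim (subst T e (ℕP.≤⇒≤ᵇ m≤n))

>⇒≤ᵇ-false : ∀ {m n} → n < m → (m ≤ᵇ n) ≡ false
>⇒≤ᵇ-false {m} {n} n<m with m ≤ᵇ n in e
... | false = refl
... | true  = ⊥-elim (ℕP.<⇒≱ n<m (≤ᵇ-sound m n e))

<ᵇ-complete : ∀ {m n} → m < n → (m <ᵇ n) ≡ true
<ᵇ-complete {m} {n} m<n with m <ᵇ n in e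
... | true  = refl
... | false = ⊥-elim (subst T e (ℕP.<⇒<ᵇ m<n))

≮⇒<ᵇ-false : ∀ {m n} → ¬ m < n → (m <ᵇ n) ≡ false
≮⇒<ᵇ-false {m} {n} m≮n with m <ᵇ n in e
... | false = refl
... | true  = ⊥-elim (m≮n (≤ᵇ-sound (suc m) n e))

<ᵇ-irrefl : ∀ n → (n <ᵇ n) ≡ false
<ᵇ-irrefl n = ≮⇒<ᵇ-false {n} {n} (ℕP.<-irrefl refl)

≤ᵇ⇔<ᵇ-suc : ∀ m n → (m ≤ᵇ n) ≡ (m <ᵇ suc n)
≤ᵇ⇔<ᵇ-suc zero    n       = refl
≤ᵇ⇔<ᵇ-suc (suc m) zero    = refl
≤ᵇ⇔<ᵇ-suc (suc m) (suc n) = refl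

sumMap : ∀ {A : Set} → (A → ℕ) → List A → ℕ
sumMap f []       = 0
sumMap f (x ∷ xs) = f x + sumMap f xs

count : ∀ {A : Set} → (A → Bool) → List A → ℕ
count p = sumMap (λ x → ι (p x))

sumMap-congᴬ : ∀ {A : Set} (f g : A → ℕ) xs → All (λ x → f x ≡ g x) xs → sumMap f xs ≡ sumMap g xs
sumMap-congᴬ f g []       []       = refl
sumMap-congᴬ f g (x ∷ xs) (e ∷ es) = cong₂ _+_ e (sumMap-congᴬ f g xs es)

sumMap-cong : ∀ {A : Set} (f g : A → ℕ) xs → (∀ x → f x ≡ g x) → sumMap f xs ≡ sumMap g xs
sumMap-cong f g xs e = sumMap-congᴬ f g xs (All.universal e xs)

sumMap-*ˡ : ∀ {A : Set} c (f : A → ℕ) xs → sumMap (λ x → c * f x) xs ≡ c * sumMap f xs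
sumMap-*ˡ c f []       = sym (ℕP.*-zeroʳ c)
sumMap-*ˡ c f (x ∷ xs) = trans (cong (c * f x +_) (sumMap-*ˡ c f xs)) (sym (ℕP.*-distribˡ-+ c (f x) (sumMap f xs)))

sumMap-map : ∀ {A C : Set} (f : C → ℕ) (g : A → C) xs → sumMap f (map g xs) ≡ sumMap (λ x → f (g x)) xs
sumMap-map f g []       = refl
sumMap-map f g (x ∷ xs) = cong (f (g x) +_) (sumMap-map f g xs)

sumMap-++ : ∀ {A : Set} (f : A → ℕ) xs ys → sumMap f (xs ++ ys) ≡ sumMap f xs + sumMap f ys
sumMap-++ f []       ys = refl
sumMap-++ f (x ∷ xs) ys = trans (cong (f x +_) (sumMap-++ f xs ys)) (sym (ℕP.+-assoc (f x) (sumMap f xs) _))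

sumMap-+ : ∀ {A : Set} (f g : A → ℕ) xs → sumMap (λ x → f x + g x) xs ≡ sumMap f xs + sumMap g xs
sumMap-+ f g []       = refl
sumMap-+ f g (x ∷ xs) = trans (cong (f x + g x +_) (sumMap-+ f g xs)) (+-interchange (f x) (g x) (sumMap f xs) (sumMap g xs))

sumMap-zero : ∀ {A : Set} (f : A → ℕ) xs → All (λ x → f x ≡ 0) xs → sumMap f xs ≡ 0
sumMap-zero f []       []       = refl
sumMap-zero f (x ∷ xs) (e ∷ es) rewrite e = sumMap-zero f xs es

count-∧ˡ : ∀ {A : Set} b (p : A → Bool) xs → count (λ x → b ∧ p x) xs ≡ ι b * count p xs
count-∧ˡ b p xs = trans (sumMap-cong _ _ xs (λ x → ι-∧ b (p x))) (sumMap-*ˡ (ι b) (λ x → ι (p x)) xs)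

filterᵇ-∷ : ∀ {A : Set} (p : A → Bool) x xs → filterᵇ p (x ∷ xs) ≡ (if p x then x ∷ filterᵇ p xs else filterᵇ p xs)
filterᵇ-∷ p x xs with p x
... | true  = refl
... | false = refl

filterᵇ-++ : ∀ {A : Set} (p : A → Bool) xs ys → filterᵇ p (xs ++ ys) ≡ filterᵇ p xs ++ filterᵇ p ys
filterᵇ-++ p = filter-++ (λ x → T? (p x))

filterᵇ-map : ∀ {A C : Set} (p : C → Bool) (f : A → C) xs → filterᵇ p (map f xs) ≡ map f (filterᵇ (λ a → p (f a)) xs)
filterᵇ-map p f []       = refl
filterᵇ-map p f (x ∷ xs) with p (f x)
... | true  = cong (f x ∷_) (filterᵇ-map p f xs)
... | false = filterᵇ-map p f xs

filterᵇ-congᴬ : ∀ {A : Set} (p q : A → Bool) xs → All (λ x → p x ≡ q x) xs → filterᵇ p xs ≡ filterᵇ q xs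
filterᵇ-congᴬ p q []       []       = refl
filterᵇ-congᴬ p q (x ∷ xs) (e ∷ es) rewrite filterᵇ-∷ p x xs | filterᵇ-∷ q x xs | e | filterᵇ-congᴬ p q xs es = refl

filterᵇ-cong : ∀ {A : Set} (p q : A → Bool) xs → (∀ x → p x ≡ q x) → filterᵇ p xs ≡ filterᵇ q xs
filterᵇ-cong p q xs e = filterᵇ-congᴬ p q xs (All.universal e xs)

filterᵇ-none : ∀ {A : Set} (p : A → Bool) xs → All (λ x → p x ≡ false) xs → filterᵇ p xs ≡ []
filterᵇ-none p []       []       = refl
filterᵇ-none p (x ∷ xs) (e ∷ es) rewrite filterᵇ-∷ p x xs | e = filterᵇ-none p xs es

all-++ : ∀ {A : Set} (p : A → Bool) xs ys → all p (xs ++ ys) ≡ all p xs ∧ all p ys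
all-++ p []       ys = refl
all-++ p (x ∷ xs) ys rewrite all-++ p xs ys = sym (BP.∧-assoc (p x) (all p xs) (all p ys))

any-++ : ∀ {A : Set} (p : A → Bool) xs ys → any p (xs ++ ys) ≡ any p xs ∨ any p ys
any-++ p []       ys = refl
any-++ p (x ∷ xs) ys rewrite any-++ p xs ys = sym (BP.∨-assoc (p x) (any p xs) (any p ys))

all-map : ∀ {A C : Set} (p : C → Bool) (f : A → C) xs → all p (map f xs) ≡ all (λ a → p (f a)) xs
all-map p f []       = refl
all-map p f (x ∷ xs) = cong (p (f x) ∧_) (all-map p f xs)

any-map : ∀ {A C : Set} (p : C → Bool) (f : A → C) xs → any p (map f xs) ≡ any (λ a → p (f a)) xs
any-map p f []       = refl
any-map p f (x ∷ xs) = cong (p (f x) ∨_) (any-map p f xs)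

all-congᴬ : ∀ {A : Set} (p q : A → Bool) xs → All (λ x → p x ≡ q x) xs → all p xs ≡ all q xs
all-congᴬ p q []       []       = refl
all-congᴬ p q (x ∷ xs) (e ∷ es) = cong₂ _∧_ e (all-congᴬ p q xs es)

all-cong : ∀ {A : Set} (p q : A → Bool) xs → (∀ x → p x ≡ q x) → all p xs ≡ all q xs
all-cong p q xs e = all-congᴬ p q xs (All.universal e xs)

any-false : ∀ {A : Set} (xs : List A) → any (λ _ → false) xs ≡ false
any-false []       = refl
any-false (x ∷ xs) = any-false xs

all-filterᵇ : ∀ {A : Set} (q p : A → Bool) xs → all q (filterᵇ p xs) ≡ all (λ x → not (p x) ∨ q x) xs
all-filterᵇ q p []       = refl
all-filterᵇ q p (x ∷ xs) rewrite filterᵇ-∷ p x xs with p x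
... | true  = cong (q x ∧_) (all-filterᵇ q p xs)
... | false = all-filterᵇ q p xs

all-not∧not : ∀ {A : Set} (a b : A → Bool) xs → all (λ x → not (a x) ∧ not (b x)) xs ≡ not (any a xs) ∧ not (any b xs)
all-not∧not a b []       = refl
all-not∧not a b (x ∷ xs) rewrite all-not∧not a b xs with a x | b x
... | true  | _     = refl
... | false | true  = sym (BP.∧-zeroʳ (not (any a xs)))
... | false | false = refl

any-≡ᵇ-upTo : ∀ c k → any (c ≡ᵇ_) (upTo k) ≡ (c <ᵇ k)
any-≡ᵇ-upTo c zero    = refl
any-≡ᵇ-upTo c (suc k) = begin
  any (c ≡ᵇ_) (upTo (suc k))                 ≡⟨ cong (any (c ≡ᵇ_)) (sym (upTo-∷ʳ k)) ⟩
  any (c ≡ᵇ_) (upTo k ++ k ∷ [])             ≡⟨ any-++ (c ≡ᵇ_) (upTo k) (k ∷ []) ⟩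
  any (c ≡ᵇ_) (upTo k) ∨ ((c ≡ᵇ k) ∨ false)  ≡⟨ cong₂ _∨_ (any-≡ᵇ-upTo c k) (BP.∨-identityʳ (c ≡ᵇ k)) ⟩
  (c <ᵇ k) ∨ (c ≡ᵇ k)                        ≡⟨ <ᵇ∨≡ᵇ c k ⟩
  (c <ᵇ suc k)                               ∎
  where
  open ≡-Reasoning
  <ᵇ∨≡ᵇ : ∀ c k → ((c <ᵇ k) ∨ (c ≡ᵇ k)) ≡ (c <ᵇ suc k)
  <ᵇ∨≡ᵇ zero    zero    = refl
  <ᵇ∨≡ᵇ zero    (suc k) = refl
  <ᵇ∨≡ᵇ (suc c) zero    = refl
  <ᵇ∨≡ᵇ (suc c) (suc k) = <ᵇ∨≡ᵇ c k

all-<ᵇ-upTo : ∀ x m → all (_<ᵇ m) (upTo x) ≡ (x ≤ᵇ m)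
all-<ᵇ-upTo zero    m = refl
all-<ᵇ-upTo (suc x) m = begin
  all (_<ᵇ m) (upTo (suc x))           ≡⟨ cong (all (_<ᵇ m)) (sym (upTo-∷ʳ x)) ⟩
  all (_<ᵇ m) (upTo x ++ x ∷ [])       ≡⟨ all-++ (_<ᵇ m) (upTo x) (x ∷ []) ⟩
  all (_<ᵇ m) (upTo x) ∧ ((x <ᵇ m) ∧ true) ≡⟨ cong₂ _∧_ (all-<ᵇ-upTo x m) (BP.∧-identityʳ _) ⟩
  (x ≤ᵇ m) ∧ (x <ᵇ m)                  ≡⟨ ≤ᵇ∧<ᵇ x m ⟩
  (x <ᵇ m)                             ∎
  where
  open ≡-Reasoning
  <ᵇ∧suc<ᵇ : ∀ x m → ((x <ᵇ m) ∧ (suc x <ᵇ m)) ≡ (suc x <ᵇ m)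
  <ᵇ∧suc<ᵇ x       zero    = refl
  <ᵇ∧suc<ᵇ zero    (suc m) = refl
  <ᵇ∧suc<ᵇ (suc x) (suc m) = <ᵇ∧suc<ᵇ x m
  ≤ᵇ∧<ᵇ : ∀ x m → ((x ≤ᵇ m) ∧ (x <ᵇ m)) ≡ (x <ᵇ m)
  ≤ᵇ∧<ᵇ zero    m = refl
  ≤ᵇ∧<ᵇ (suc x) m = <ᵇ∧suc<ᵇ x m

IsPartition : List ℕ → Set
IsPartition P = Linked _≥_ P × All (1 ≤_) P

isPartition : ∀ la → IsPartition (parts la)
isPartition la = weakDec la , positive la

-- the largest part; first [] = 0 matches the convention λ_i = 0 beyond the length
first : List ℕ → ℕ
first []      = 0
first (p ∷ _) = p

rest : List ℕ → List ℕ
rest []      = []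
rest (_ ∷ P) = P

part : List ℕ → ℕ → ℕ
part []      i       = 0
part (p ∷ P) zero    = p
part (p ∷ P) (suc i) = part P i

part₀≡first : ∀ P → part P 0 ≡ first P
part₀≡first []      = refl
part₀≡first (p ∷ P) = refl

first≥second : ∀ P → Linked _≥_ P → first (rest P) ≤ first P
first≥second []          _         = z≤n
first≥second (p ∷ [])    _         = z≤n
first≥second (p ∷ q ∷ P) (q≤p ∷ _) = q≤p

part-antitone : ∀ P → Linked _≥_ P → ∀ i → part P (suc i) ≤ part P i
part-antitone []          _          i       = z≤n
part-antitone (p ∷ [])    _          zero    = z≤n
part-antitone (p ∷ [])    _          (suc i) = z≤n
part-antitone (p ∷ q ∷ P) (q≤p ∷ _)  zero    = q≤p
part-antitone (p ∷ q ∷ P) (_ ∷ lP)   (suc i) = part-antitone (q ∷ P) lP i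

IsPartition-rest : ∀ P → IsPartition P → IsPartition (rest P)
IsPartition-rest []      isP            = isP
IsPartition-rest (p ∷ P) (lP , _ ∷ pos) = Linked.tail lP , pos

IsPartition-∷ : ∀ p P → IsPartition P → 1 ≤ p → first P ≤ p → IsPartition (p ∷ P)
IsPartition-∷ p []      _          1≤p _   = [-] , 1≤p ∷ []
IsPartition-∷ p (q ∷ P) (lP , pos) 1≤p q≤p = q≤p ∷ lP , 1≤p ∷ pos

eqList⇒≡ : ∀ P Q → eqList P Q ≡ true → P ≡ Q
eqList⇒≡ []      []      _ = refl
eqList⇒≡ (p ∷ P) (q ∷ Q) e = cong₂ _∷_ (≡ᵇ-sound p q (∧-trueˡ e)) (eqList⇒≡ P Q (∧-trueʳ {p ≡ᵇ q} e))

≢⇒eqList-false : ∀ P Q → ¬ P ≡ Q → eqList P Q ≡ false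
≢⇒eqList-false P Q P≢Q with eqList P Q in e
... | true  = ⊥-elim (P≢Q (eqList⇒≡ P Q e))
... | false = refl

eqList-refl : ∀ P → eqList P P ≡ true
eqList-refl []      = refl
eqList-refl (p ∷ P) rewrite ≡ᵇ-refl p = eqList-refl P

eqList-sym : ∀ P Q → eqList P Q ≡ eqList Q P
eqList-sym []      []      = refl
eqList-sym []      (q ∷ Q) = refl
eqList-sym (p ∷ P) []      = refl
eqList-sym (p ∷ P) (q ∷ Q) = cong₂ _∧_ (≡ᵇ-sym p q) (eqList-sym P Q)
  where
  ≡ᵇ-sym : ∀ m n → (m ≡ᵇ n) ≡ (n ≡ᵇ m)
  ≡ᵇ-sym zero    zero    = refl
  ≡ᵇ-sym zero    (suc n) = refl
  ≡ᵇ-sym (suc m) zero    = refl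
  ≡ᵇ-sym (suc m) (suc n) = ≡ᵇ-sym m n

-- The list versions of the notions in Defs: a₁ x y and a₂ x y are definitionally a₁ᴸ (parts x) (parts y) and a₂ᴸ (parts x) (parts y).

diagramᴸ : List ℕ → List Box
diagramᴸ = diagramFrom 0

_⊆ᴸ_ : List ℕ → List ℕ → Bool
X ⊆ᴸ Y = all (_∈ᵇ diagramᴸ Y) (diagramᴸ X)

skewᴸ : List ℕ → List ℕ → List Box
skewᴸ Y X = filterᵇ (λ b → not (b ∈ᵇ diagramᴸ X)) (diagramᴸ Y)

innerCornersᴸ : List ℕ → List Box
innerCornersᴸ X = filterᵇ (λ b → isDownClosed (removeBox b (diagramᴸ X))) (diagramᴸ X)

a₁ᴸ : List ℕ → List ℕ → ℕ
a₁ᴸ X Y = ι ((X ⊆ᴸ Y) ∧ (length (skewᴸ Y X) ≡ᵇ 1)) + (if eqList X Y then length (innerCornersᴸ X) else 0)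

a₂ᴸ : List ℕ → List ℕ → ℕ
a₂ᴸ X Y = ι (((X ⊆ᴸ Y) ∧ not (eqList X Y)) ∧ isRookStrip (skewᴸ Y X))

inRow₀ : ℕ → Box
inRow₀ c = 0 , c

below : Box → Box
below (i , j) = suc i , j

diagramFrom-suc : ∀ i ks → diagramFrom (suc i) ks ≡ map below (diagramFrom i ks)
diagramFrom-suc i []       = refl
diagramFrom-suc i (k ∷ ks) = begin
  map (suc i ,_) (upTo k) ++ diagramFrom (suc (suc i)) ks
    ≡⟨ cong₂ _++_ (map-∘ {g = below} {f = (i ,_)} (upTo k)) (diagramFrom-suc (suc i) ks) ⟩
  map below (map (i ,_) (upTo k)) ++ map below (diagramFrom (suc i) ks)
    ≡⟨ map-++ below (map (i ,_) (upTo k)) (diagramFrom (suc i) ks) ⟨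
  map below (map (i ,_) (upTo k) ++ diagramFrom (suc i) ks) ∎
  where open ≡-Reasoning

diagramᴸ-∷ : ∀ k ks → diagramᴸ (k ∷ ks) ≡ map inRow₀ (upTo k) ++ map below (diagramᴸ ks)
diagramᴸ-∷ k ks = cong (map inRow₀ (upTo k) ++_) (diagramFrom-suc 0 ks)

∈-diagramᴸ : ∀ X r c → ((r , c) ∈ᵇ diagramᴸ X) ≡ (c <ᵇ part X r)
∈-diagramᴸ []       r c = refl
∈-diagramᴸ (k ∷ ks) r c = begin
  any (eqBox (r , c)) (diagramᴸ (k ∷ ks))
    ≡⟨ cong (any (eqBox (r , c))) (diagramᴸ-∷ k ks) ⟩
  any (eqBox (r , c)) (map inRow₀ (upTo k) ++ map below (diagramᴸ ks))
    ≡⟨ any-++ (eqBox (r , c)) (map inRow₀ (upTo k)) _ ⟩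
  any (eqBox (r , c)) (map inRow₀ (upTo k)) ∨ any (eqBox (r , c)) (map below (diagramᴸ ks))
    ≡⟨ cong₂ _∨_ (any-map (eqBox (r , c)) inRow₀ (upTo k)) (any-map (eqBox (r , c)) below (diagramᴸ ks)) ⟩
  any (λ j → eqBox (r , c) (0 , j)) (upTo k) ∨ any (λ b → eqBox (r , c) (below b)) (diagramᴸ ks)
    ≡⟨ byRow r ⟩
  (c <ᵇ part (k ∷ ks) r) ∎
  where
  open ≡-Reasoning
  byRow : ∀ r → (any (λ j → eqBox (r , c) (0 , j)) (upTo k) ∨ any (λ b → eqBox (r , c) (below b)) (diagramᴸ ks))
              ≡ (c <ᵇ part (k ∷ ks) r)
  byRow zero    = trans (cong₂ _∨_ (any-≡ᵇ-upTo c k) (any-false (diagramᴸ ks))) (BP.∨-identityʳ _)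
  byRow (suc r) = trans (cong (_∨ any (λ b → eqBox (suc r , c) (below b)) (diagramᴸ ks)) (any-false (upTo k))) (∈-diagramᴸ ks r c)

below-∈-diagramᴸ : ∀ Y b → (below b ∈ᵇ diagramᴸ Y) ≡ (b ∈ᵇ diagramᴸ (rest Y))
below-∈-diagramᴸ []      (r , c) = refl
below-∈-diagramᴸ (y ∷ Y) (r , c) = trans (∈-diagramᴸ (y ∷ Y) (suc r) c) (sym (∈-diagramᴸ Y r c))

first-∈-diagramᴸ : ∀ Y c → ((0 , c) ∈ᵇ diagramᴸ Y) ≡ (c <ᵇ first Y)
first-∈-diagramᴸ []      c = refl
first-∈-diagramᴸ (y ∷ Y) c = ∈-diagramᴸ (y ∷ Y) 0 c

InDiagram : List ℕ → Box → Set
InDiagram X (r , c) = c < part X r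

diagramᴸ-sound : ∀ X → All (InDiagram X) (diagramᴸ X)
diagramᴸ-sound []      = []
diagramᴸ-sound (x ∷ X) = subst (All (InDiagram (x ∷ X))) (sym (diagramᴸ-∷ x X))
  (++⁺ (map⁺ (all-upTo x)) (map⁺ (All.map (λ {b} → stepDown b) (diagramᴸ-sound X))))
  where
  stepDown : ∀ b → InDiagram X b → InDiagram (x ∷ X) (below b)
  stepDown (r , c) c<X_r = c<X_r

_≼_ : List ℕ → List ℕ → Bool
[]      ≼ Y = true
(x ∷ X) ≼ Y = (x ≤ᵇ first Y) ∧ (X ≼ rest Y)

⊆ᴸ≡≼ : ∀ X Y → (X ⊆ᴸ Y) ≡ (X ≼ Y)
⊆ᴸ≡≼ []      Y = refl
⊆ᴸ≡≼ (x ∷ X) Y = begin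
  all (_∈ᵇ diagramᴸ Y) (diagramᴸ (x ∷ X))
    ≡⟨ cong (all (_∈ᵇ diagramᴸ Y)) (diagramᴸ-∷ x X) ⟩
  all (_∈ᵇ diagramᴸ Y) (map inRow₀ (upTo x) ++ map below (diagramᴸ X))
    ≡⟨ all-++ (_∈ᵇ diagramᴸ Y) (map inRow₀ (upTo x)) _ ⟩
  all (_∈ᵇ diagramᴸ Y) (map inRow₀ (upTo x)) ∧ all (_∈ᵇ diagramᴸ Y) (map below (diagramᴸ X))
    ≡⟨ cong₂ _∧_ (all-map (_∈ᵇ diagramᴸ Y) inRow₀ (upTo x)) (all-map (_∈ᵇ diagramᴸ Y) below (diagramᴸ X)) ⟩
  all (λ c → (0 , c) ∈ᵇ diagramᴸ Y) (upTo x) ∧ all (λ b → below b ∈ᵇ diagramᴸ Y) (diagramᴸ X)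
    ≡⟨ cong₂ _∧_ (all-cong _ _ (upTo x) (first-∈-diagramᴸ Y)) (all-cong _ _ (diagramᴸ X) (below-∈-diagramᴸ Y)) ⟩
  all (_<ᵇ first Y) (upTo x) ∧ (X ⊆ᴸ rest Y)
    ≡⟨ cong₂ _∧_ (all-<ᵇ-upTo x (first Y)) (⊆ᴸ≡≼ X (rest Y)) ⟩
  (x ∷ X) ≼ Y ∎
  where open ≡-Reasoning

columnsFrom : ℕ → ℕ → List ℕ
columnsFrom a y = filterᵇ (λ c → not (c <ᵇ a)) (upTo y)

skewᴸ-∷ : ∀ y Y X → skewᴸ (y ∷ Y) X ≡ map inRow₀ (columnsFrom (first X) y) ++ map below (skewᴸ Y (rest X))
skewᴸ-∷ y Y X = begin
  filterᵇ outside (diagramᴸ (y ∷ Y))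
    ≡⟨ cong (filterᵇ outside) (diagramᴸ-∷ y Y) ⟩
  filterᵇ outside (map inRow₀ (upTo y) ++ map below (diagramᴸ Y))
    ≡⟨ filterᵇ-++ outside (map inRow₀ (upTo y)) _ ⟩
  filterᵇ outside (map inRow₀ (upTo y)) ++ filterᵇ outside (map below (diagramᴸ Y))
    ≡⟨ cong₂ _++_ (filterᵇ-map outside inRow₀ (upTo y)) (filterᵇ-map outside below (diagramᴸ Y)) ⟩
  map inRow₀ (filterᵇ (λ c → outside (0 , c)) (upTo y)) ++ map below (filterᵇ (λ b → outside (below b)) (diagramᴸ Y))
    ≡⟨ cong₂ (λ u v → map inRow₀ u ++ map below v)
             (filterᵇ-cong _ _ (upTo y) (λ c → cong not (first-∈-diagramᴸ X c)))
             (filterᵇ-cong _ _ (diagramᴸ Y) (λ b → cong not (below-∈-diagramᴸ X b))) ⟩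
  map inRow₀ (columnsFrom (first X) y) ++ map below (skewᴸ Y (rest X)) ∎
  where
  open ≡-Reasoning
  outside : Box → Bool
  outside b = not (b ∈ᵇ diagramᴸ X)

skewSize : List ℕ → List ℕ → ℕ
skewSize []      X = 0
skewSize (y ∷ Y) X = (y ∸ first X) + skewSize Y (rest X)

length-columnsFrom : ∀ a y → length (columnsFrom a y) ≡ y ∸ a
length-columnsFrom a zero    = sym (ℕP.0∸n≡0 a)
length-columnsFrom a (suc y) = begin
  length (filterᵇ atLeast-a (upTo (suc y)))
    ≡⟨ cong (λ cs → length (filterᵇ atLeast-a cs)) (sym (upTo-∷ʳ y)) ⟩
  length (filterᵇ atLeast-a (upTo y ++ y ∷ []))
    ≡⟨ cong length (filterᵇ-++ atLeast-a (upTo y) (y ∷ [])) ⟩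
  length (columnsFrom a y ++ filterᵇ atLeast-a (y ∷ []))
    ≡⟨ length-++ (columnsFrom a y) ⟩
  length (columnsFrom a y) + length (filterᵇ atLeast-a (y ∷ []))
    ≡⟨ cong₂ _+_ (length-columnsFrom a y) (lastColumn y) ⟩
  (y ∸ a) + ι (not (y <ᵇ a))
    ≡⟨ ∸-step y a ⟩
  suc y ∸ a ∎
  where
  open ≡-Reasoning
  atLeast-a : ℕ → Bool
  atLeast-a c = not (c <ᵇ a)
  lastColumn : ∀ y → length (filterᵇ atLeast-a (y ∷ [])) ≡ ι (not (y <ᵇ a))
  lastColumn y with not (y <ᵇ a)
  ... | true  = refl
  ... | false = refl
  ∸-step : ∀ y a → (y ∸ a) + ι (not (y <ᵇ a)) ≡ suc y ∸ a
  ∸-step y       zero    = ℕP.+-comm y 1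
  ∸-step zero    (suc a) = sym (ℕP.0∸n≡0 a)
  ∸-step (suc y) (suc a) = ∸-step y a

length-skewᴸ : ∀ Y X → length (skewᴸ Y X) ≡ skewSize Y X
length-skewᴸ []      X = refl
length-skewᴸ (y ∷ Y) X = begin
  length (skewᴸ (y ∷ Y) X)
    ≡⟨ cong length (skewᴸ-∷ y Y X) ⟩
  length (map inRow₀ (columnsFrom (first X) y) ++ map below (skewᴸ Y (rest X)))
    ≡⟨ length-++ (map inRow₀ (columnsFrom (first X) y)) ⟩
  length (map inRow₀ (columnsFrom (first X) y)) + length (map below (skewᴸ Y (rest X)))
    ≡⟨ cong₂ _+_ (trans (length-map inRow₀ (columnsFrom (first X) y)) (length-columnsFrom (first X) y))
                 (trans (length-map below (skewᴸ Y (rest X))) (length-skewᴸ Y (rest X))) ⟩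
  skewSize (y ∷ Y) X ∎
  where open ≡-Reasoning

atMostOnePerRow : List ℕ → List ℕ → Bool
atMostOnePerRow []      X = true
atMostOnePerRow (y ∷ Y) X = ((y ∸ first X) ≤ᵇ 1) ∧ atMostOnePerRow Y (rest X)

skewColumns : List ℕ → List ℕ → List ℕ
skewColumns []      X = []
skewColumns (y ∷ Y) X = columnsFrom (first X) y ++ skewColumns Y (rest X)

noDup-++ : ∀ xs ys → All (λ x → any (x ≡ᵇ_) ys ≡ false) xs → noDup (xs ++ ys) ≡ noDup xs ∧ noDup ys
noDup-++ []       ys []       = refl
noDup-++ (x ∷ xs) ys (h ∷ hs) = begin
  not (any (x ≡ᵇ_) (xs ++ ys)) ∧ noDup (xs ++ ys)
    ≡⟨ cong₂ (λ u v → not u ∧ v) (any-++ (x ≡ᵇ_) xs ys) (noDup-++ xs ys hs) ⟩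
  not (any (x ≡ᵇ_) xs ∨ any (x ≡ᵇ_) ys) ∧ (noDup xs ∧ noDup ys)
    ≡⟨ cong (λ u → not (any (x ≡ᵇ_) xs ∨ u) ∧ (noDup xs ∧ noDup ys)) h ⟩
  not (any (x ≡ᵇ_) xs ∨ false) ∧ (noDup xs ∧ noDup ys)
    ≡⟨ cong (λ u → not u ∧ (noDup xs ∧ noDup ys)) (BP.∨-identityʳ (any (x ≡ᵇ_) xs)) ⟩
  not (any (x ≡ᵇ_) xs) ∧ (noDup xs ∧ noDup ys)
    ≡⟨ BP.∧-assoc (not (any (x ≡ᵇ_) xs)) (noDup xs) (noDup ys) ⟨
  (not (any (x ≡ᵇ_) xs) ∧ noDup xs) ∧ noDup ys ∎
  where open ≡-Reasoning

noDup-const₀ : ∀ {A : Set} (xs : List A) → noDup (map (λ _ → 0) xs) ≡ (length xs ≤ᵇ 1)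
noDup-const₀ []           = refl
noDup-const₀ (a ∷ [])     = refl
noDup-const₀ (a ∷ b ∷ xs) = refl

noDup-map-suc : ∀ ns → noDup (map suc ns) ≡ noDup ns
noDup-map-suc []       = refl
noDup-map-suc (n ∷ ns) = cong₂ (λ u v → not u ∧ v) (any-suc n ns) (noDup-map-suc ns)
  where
  any-suc : ∀ n ns → any (suc n ≡ᵇ_) (map suc ns) ≡ any (n ≡ᵇ_) ns
  any-suc n []       = refl
  any-suc n (m ∷ ns) = cong ((n ≡ᵇ m) ∨_) (any-suc n ns)

zero-∉-map-suc : ∀ ns → any (0 ≡ᵇ_) (map suc ns) ≡ false
zero-∉-map-suc []       = refl
zero-∉-map-suc (n ∷ ns) = zero-∉-map-suc ns

rows-skewᴸ : ∀ Y X → noDup (map proj₁ (skewᴸ Y X)) ≡ atMostOnePerRow Y X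
rows-skewᴸ []      X = refl
rows-skewᴸ (y ∷ Y) X = begin
  noDup (map proj₁ (skewᴸ (y ∷ Y) X))
    ≡⟨ cong (λ S → noDup (map proj₁ S)) (skewᴸ-∷ y Y X) ⟩
  noDup (map proj₁ (map inRow₀ C ++ map below S))
    ≡⟨ cong noDup (map-++ proj₁ (map inRow₀ C) (map below S)) ⟩
  noDup (map proj₁ (map inRow₀ C) ++ map proj₁ (map below S))
    ≡⟨ cong₂ (λ u v → noDup (u ++ v)) (sym (map-∘ {g = proj₁} {f = inRow₀} C)) (trans (sym (map-∘ {g = proj₁} {f = below} S)) (map-∘ {g = suc} {f = proj₁} S)) ⟩
  noDup (map (λ _ → 0) C ++ map suc (map proj₁ S))
    ≡⟨ noDup-++ (map (λ _ → 0) C) (map suc (map proj₁ S)) (map⁺ (All.universal (λ _ → zero-∉-map-suc (map proj₁ S)) C)) ⟩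
  noDup (map (λ _ → 0) C) ∧ noDup (map suc (map proj₁ S))
    ≡⟨ cong₂ _∧_ (noDup-const₀ C) (noDup-map-suc (map proj₁ S)) ⟩
  (length C ≤ᵇ 1) ∧ noDup (map proj₁ S)
    ≡⟨ cong₂ _∧_ (cong (_≤ᵇ 1) (length-columnsFrom (first X) y)) (rows-skewᴸ Y (rest X)) ⟩
  atMostOnePerRow (y ∷ Y) X ∎
  where
  open ≡-Reasoning
  C = columnsFrom (first X) y
  S = skewᴸ Y (rest X)

columns-skewᴸ : ∀ Y X → map proj₂ (skewᴸ Y X) ≡ skewColumns Y X
columns-skewᴸ []      X = refl
columns-skewᴸ (y ∷ Y) X = begin
  map proj₂ (skewᴸ (y ∷ Y) X)
    ≡⟨ cong (map proj₂) (skewᴸ-∷ y Y X) ⟩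
  map proj₂ (map inRow₀ C ++ map below S)
    ≡⟨ map-++ proj₂ (map inRow₀ C) (map below S) ⟩
  map proj₂ (map inRow₀ C) ++ map proj₂ (map below S)
    ≡⟨ cong₂ _++_ (trans (sym (map-∘ {g = proj₂} {f = inRow₀} C)) (map-id C)) (trans (sym (map-∘ {g = proj₂} {f = below} S)) (columns-skewᴸ Y (rest X))) ⟩
  skewColumns (y ∷ Y) X ∎
  where
  open ≡-Reasoning
  C = columnsFrom (first X) y
  S = skewᴸ Y (rest X)

eqBox-sound : ∀ a b → eqBox a b ≡ true → a ≡ b
eqBox-sound (i , j) (i′ , j′) e = cong₂ _,_ (≡ᵇ-sound i i′ (∧-trueˡ e)) (≡ᵇ-sound j j′ (∧-trueʳ {i ≡ᵇ i′} e))

∈ᵇ-filterᵇ : ∀ b (p : Box → Bool) D → (b ∈ᵇ filterᵇ p D) ≡ p b ∧ (b ∈ᵇ D)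
∈ᵇ-filterᵇ b p []      = sym (BP.∧-zeroʳ (p b))
∈ᵇ-filterᵇ b p (d ∷ D) rewrite filterᵇ-∷ p d D with p d in pd
... | true  = trans (cong (eqBox b d ∨_) (∈ᵇ-filterᵇ b p D)) (kept (eqBox b d) (λ e → trans (cong p (eqBox-sound b d e)) pd))
  where
  kept : ∀ e → (e ≡ true → p b ≡ true) → (e ∨ (p b ∧ (b ∈ᵇ D))) ≡ p b ∧ (e ∨ (b ∈ᵇ D))
  kept true  h rewrite h refl = refl
  kept false h = refl
... | false = trans (∈ᵇ-filterᵇ b p D) (dropped (eqBox b d) (λ e → trans (cong p (eqBox-sound b d e)) pd))
  where
  dropped : ∀ e → (e ≡ true → p b ≡ false) → p b ∧ (b ∈ᵇ D) ≡ p b ∧ (e ∨ (b ∈ᵇ D))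
  dropped true  h rewrite h refl = refl
  dropped false h = refl

hasBoxAbove : List Box → ℕ → ℕ → Bool
hasBoxAbove S zero    j = true
hasBoxAbove S (suc i) j = (i , j) ∈ᵇ S

hasBoxLeft : List Box → ℕ → ℕ → Bool
hasBoxLeft S i zero    = true
hasBoxLeft S i (suc j) = (i , j) ∈ᵇ S

isDownClosed≡ : ∀ S → isDownClosed S ≡ all (λ { (i , j) → hasBoxAbove S i j ∧ hasBoxLeft S i j }) S
isDownClosed≡ S = all-cong _ _ S supported
  where
  supported : ∀ b → _ ≡ _
  supported (zero  , zero)  = refl
  supported (zero  , suc j) = refl
  supported (suc i , zero)  = refl
  supported (suc i , suc j) = refl

isCorner : List ℕ → Box → Bool
isCorner X (r , c) = not (c <ᵇ part X (suc r)) ∧ not (suc c <ᵇ part X r)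

-- after removing (r , c), a box d of X loses its support exactly when d is the box below or to the right of (r , c)
supportAfterRemoval : ∀ X → Linked _≥_ X → ∀ r c d → InDiagram X d →
  let S = removeBox (r , c) (diagramᴸ X) in
  (not (not (eqBox (r , c) d)) ∨ (hasBoxAbove S (proj₁ d) (proj₂ d) ∧ hasBoxLeft S (proj₁ d) (proj₂ d)))
    ≡ (not (eqBox (suc r , c) d) ∧ not (eqBox (r , suc c) d))
supportAfterRemoval X lX r c (i , j) j<X_i with eqBox (r , c) (i , j) in e
... | true rewrite sym (≡ᵇ-sound r i (∧-trueˡ e)) | sym (≡ᵇ-sound c j (∧-trueʳ {r ≡ᵇ i} e)) | >⇒≡ᵇ-false (ℕP.n<1+n r) | >⇒≡ᵇ-false (ℕP.n<1+n c) =
  sym (cong not (BP.∧-zeroʳ (r ≡ᵇ r)))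
... | false = cong₂ _∧_ (above i j<X_i) (left j j<X_i)
  where
  S = removeBox (r , c) (diagramᴸ X)
  stillThere : ∀ i′ j′ → j′ < part X i′ → ((i′ , j′) ∈ᵇ S) ≡ not (eqBox (r , c) (i′ , j′))
  stillThere i′ j′ j′<X_i′ =
    trans (∈ᵇ-filterᵇ (i′ , j′) (λ b → not (eqBox (r , c) b)) (diagramᴸ X))
          (trans (cong (not (eqBox (r , c) (i′ , j′)) ∧_) (trans (∈-diagramᴸ X i′ j′) (<ᵇ-complete j′<X_i′)))
                 (BP.∧-identityʳ _))
  above : ∀ i → InDiagram X (i , j) → hasBoxAbove S i j ≡ not (eqBox (suc r , c) (i , j))
  above zero     _      = refl
  above (suc i′) j<X_i  = stillThere i′ j (ℕP.<-≤-trans j<X_i (part-antitone X lX i′))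
  left : ∀ j → InDiagram X (i , j) → hasBoxLeft S i j ≡ not (eqBox (r , suc c) (i , j))
  left zero     _     = sym (cong not (BP.∧-zeroʳ (r ≡ᵇ i)))
  left (suc j′) j<X_i = stillThere i j′ (ℕP.<-trans (ℕP.n<1+n j′) j<X_i)

isDownClosed-removeBox : ∀ X → Linked _≥_ X → ∀ b → isDownClosed (removeBox b (diagramᴸ X)) ≡ isCorner X b
isDownClosed-removeBox X lX (r , c) = begin
  isDownClosed S
    ≡⟨ isDownClosed≡ S ⟩
  all supported S
    ≡⟨ all-filterᵇ supported (λ d → not (eqBox (r , c) d)) (diagramᴸ X) ⟩
  all (λ d → not (not (eqBox (r , c) d)) ∨ supported d) (diagramᴸ X)
    ≡⟨ all-congᴬ _ _ (diagramᴸ X) (All.map (λ {d} → supportAfterRemoval X lX r c d) (diagramᴸ-sound X)) ⟩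
  all (λ d → not (eqBox (suc r , c) d) ∧ not (eqBox (r , suc c) d)) (diagramᴸ X)
    ≡⟨ all-not∧not (eqBox (suc r , c)) (eqBox (r , suc c)) (diagramᴸ X) ⟩
  not ((suc r , c) ∈ᵇ diagramᴸ X) ∧ not ((r , suc c) ∈ᵇ diagramᴸ X)
    ≡⟨ cong₂ (λ u v → not u ∧ not v) (∈-diagramᴸ X (suc r) c) (∈-diagramᴸ X r (suc c)) ⟩
  isCorner X (r , c) ∎
  where
  open ≡-Reasoning
  S = removeBox (r , c) (diagramᴸ X)
  supported : Box → Bool
  supported (i , j) = hasBoxAbove S i j ∧ hasBoxLeft S i j

cornerCount : List ℕ → ℕ
cornerCount []      = 0
cornerCount (x ∷ X) = ι (first X <ᵇ x) + cornerCount X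

cornersInFirstRow : ∀ a x → length (filterᵇ (λ c → not (c <ᵇ a) ∧ not (suc c <ᵇ x)) (upTo x)) ≡ ι (a <ᵇ x)
cornersInFirstRow a zero    = refl
cornersInFirstRow a (suc x) = begin
  length (filterᵇ corner (upTo (suc x)))
    ≡⟨ cong (λ cs → length (filterᵇ corner cs)) (sym (upTo-∷ʳ x)) ⟩
  length (filterᵇ corner (upTo x ++ x ∷ []))
    ≡⟨ cong length (filterᵇ-++ corner (upTo x) (x ∷ [])) ⟩
  length (filterᵇ corner (upTo x) ++ filterᵇ corner (x ∷ []))
    ≡⟨ cong (λ cs → length (cs ++ filterᵇ corner (x ∷ [])))
            (filterᵇ-none corner (upTo x) (All.map notLast (all-upTo x))) ⟩
  length (filterᵇ corner (x ∷ []))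
    ≡⟨ lastColumn ⟩
  ι (not (x <ᵇ a))
    ≡⟨ cong ι (not<ᵇ≡<ᵇsuc x a) ⟩
  ι (a <ᵇ suc x) ∎
  where
  open ≡-Reasoning
  corner : ℕ → Bool
  corner c = not (c <ᵇ a) ∧ not (suc c <ᵇ suc x)
  notLast : ∀ {c} → c < x → corner c ≡ false
  notLast {c} c<x rewrite <ᵇ-complete c<x = BP.∧-zeroʳ (not (c <ᵇ a))
  lastColumn : length (filterᵇ corner (x ∷ [])) ≡ ι (not (x <ᵇ a))
  lastColumn rewrite <ᵇ-irrefl x with x <ᵇ a
  ... | true  = refl
  ... | false = refl
  not<ᵇ≡<ᵇsuc : ∀ x a → not (x <ᵇ a) ≡ (a <ᵇ suc x)
  not<ᵇ≡<ᵇsuc x       zero    = refl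
  not<ᵇ≡<ᵇsuc zero    (suc a) = refl
  not<ᵇ≡<ᵇsuc (suc x) (suc a) = not<ᵇ≡<ᵇsuc x a

length-corners : ∀ X → length (filterᵇ (isCorner X) (diagramᴸ X)) ≡ cornerCount X
length-corners []      = refl
length-corners (x ∷ X) = begin
  length (filterᵇ corner (diagramᴸ (x ∷ X)))
    ≡⟨ cong (λ D → length (filterᵇ corner D)) (diagramᴸ-∷ x X) ⟩
  length (filterᵇ corner (map inRow₀ (upTo x) ++ map below (diagramᴸ X)))
    ≡⟨ cong length (filterᵇ-++ corner (map inRow₀ (upTo x)) (map below (diagramᴸ X))) ⟩
  length (filterᵇ corner (map inRow₀ (upTo x)) ++ filterᵇ corner (map below (diagramᴸ X)))
    ≡⟨ length-++ (filterᵇ corner (map inRow₀ (upTo x))) ⟩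
  length (filterᵇ corner (map inRow₀ (upTo x))) + length (filterᵇ corner (map below (diagramᴸ X)))
    ≡⟨ cong₂ _+_ (cong length (filterᵇ-map corner inRow₀ (upTo x))) (cong length (filterᵇ-map corner below (diagramᴸ X))) ⟩
  length (map inRow₀ (filterᵇ (λ c → corner (0 , c)) (upTo x))) + length (map below (filterᵇ (λ b → corner (below b)) (diagramᴸ X)))
    ≡⟨ cong₂ _+_ (length-map inRow₀ (filterᵇ (λ c → corner (0 , c)) (upTo x))) (length-map below (filterᵇ (λ b → corner (below b)) (diagramᴸ X))) ⟩
  length (filterᵇ (λ c → corner (0 , c)) (upTo x)) + length (filterᵇ (λ b → corner (below b)) (diagramᴸ X))
    ≡⟨ cong₂ _+_ (cong length (filterᵇ-cong _ (λ c → not (c <ᵇ first X) ∧ not (suc c <ᵇ x)) (upTo x) firstRow))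
                 (cong length (filterᵇ-cong _ (isCorner X) (diagramᴸ X) (λ { (r , c) → refl }))) ⟩
  length (filterᵇ (λ c → not (c <ᵇ first X) ∧ not (suc c <ᵇ x)) (upTo x)) + length (filterᵇ (isCorner X) (diagramᴸ X))
    ≡⟨ cong₂ _+_ (cornersInFirstRow (first X) x) (length-corners X) ⟩
  cornerCount (x ∷ X) ∎
  where
  open ≡-Reasoning
  corner = isCorner (x ∷ X)
  firstRow : ∀ c → corner (0 , c) ≡ (not (c <ᵇ first X) ∧ not (suc c <ᵇ x))
  firstRow c = cong (λ t → not (c <ᵇ t) ∧ not (suc c <ᵇ x)) (part₀≡first X)

length-innerCornersᴸ : ∀ X → Linked _≥_ X → length (innerCornersᴸ X) ≡ cornerCount X
length-innerCornersᴸ X lX =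
  trans (cong length (filterᵇ-cong _ (isCorner X) (diagramᴸ X) (isDownClosed-removeBox X lX))) (length-corners X)

_≼ʸ_ : List ℕ → List ℕ → Bool
X ≼ʸ []      = null X
X ≼ʸ (y ∷ Y) = (first X ≤ᵇ y) ∧ (rest X ≼ʸ Y)

≼≡≼ʸ : ∀ X Y → All (1 ≤_) X → (X ≼ Y) ≡ (X ≼ʸ Y)
≼≡≼ʸ []      Y       _          = sym ([]≼ʸ Y)
  where
  []≼ʸ : ∀ Y → ([] ≼ʸ Y) ≡ true
  []≼ʸ []      = refl
  []≼ʸ (y ∷ Y) = []≼ʸ Y
≼≡≼ʸ (x ∷ X) []      (1≤x ∷ _)  = cong (_∧ (X ≼ [])) (>⇒≤ᵇ-false 1≤x)
≼≡≼ʸ (x ∷ X) (y ∷ Y) (_ ∷ pos)  = cong ((x ≤ᵇ y) ∧_) (≼≡≼ʸ X Y pos)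

-- Y/P is a rook strip or empty: P_i ≤ Y_i ≤ P_i + 1 and Y_{i+1} ≤ P_i for all i
rookᵇ : List ℕ → List ℕ → Bool
rookᵇ P []      = null P
rookᵇ P (y ∷ Y) = (first P ≤ᵇ y) ∧ ((y ≤ᵇ suc (first P)) ∧ ((first Y ≤ᵇ first P) ∧ rookᵇ (rest P) Y))

Linked-rest : ∀ X → Linked _≥_ X → Linked _≥_ (rest X)
Linked-rest []      lX = lX
Linked-rest (x ∷ X) lX = Linked.tail lX

columnsFrom-empty : ∀ a y → y ≤ a → columnsFrom a y ≡ []
columnsFrom-empty a y y≤a =
  filterᵇ-none _ (upTo y) (All.map (λ c<y → cong not (<ᵇ-complete (ℕP.<-≤-trans c<y y≤a))) (all-upTo y))

columnsFrom-single : ∀ a → columnsFrom a (suc a) ≡ a ∷ []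
columnsFrom-single a = begin
  filterᵇ atLeast-a (upTo (suc a))              ≡⟨ cong (filterᵇ atLeast-a) (sym (upTo-∷ʳ a)) ⟩
  filterᵇ atLeast-a (upTo a ++ a ∷ [])          ≡⟨ filterᵇ-++ atLeast-a (upTo a) (a ∷ []) ⟩
  filterᵇ atLeast-a (upTo a) ++ filterᵇ atLeast-a (a ∷ [])
    ≡⟨ cong₂ _++_ (columnsFrom-empty a a ℕP.≤-refl) (trans (filterᵇ-∷ atLeast-a a []) (cong (λ b → if not b then a ∷ [] else []) (<ᵇ-irrefl a))) ⟩
  a ∷ [] ∎
  where
  open ≡-Reasoning
  atLeast-a : ℕ → Bool
  atLeast-a c = not (c <ᵇ a)

skewColumns-bounded : ∀ Y X → Linked _≥_ Y → All (_< first Y) (skewColumns Y X)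
skewColumns-bounded []      X _  = []
skewColumns-bounded (y ∷ Y) X lY =
  ++⁺ (filter⁺ _ (all-upTo y))
      (All.map (λ c<Y₁ → ℕP.<-≤-trans c<Y₁ (first≥second (y ∷ Y) lY)) (skewColumns-bounded Y (rest X) (Linked.tail lY)))

≡ᵇ-absent : ∀ a cs → All (_< a) cs → any (a ≡ᵇ_) cs ≡ false
≡ᵇ-absent a []       []          = refl
≡ᵇ-absent a (c ∷ cs) (c<a ∷ c<as) = cong₂ _∨_ (>⇒≡ᵇ-false c<a) (≡ᵇ-absent a cs c<as)

1+a∸b≤1⇒a≡b : ∀ a b → b ≤ a → (suc a ∸ b) ≤ 1 → a ≡ b
1+a∸b≤1⇒a≡b zero    zero    _       _        = refl
1+a∸b≤1⇒a≡b (suc a) zero    _       (s≤s ())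
1+a∸b≤1⇒a≡b (suc a) (suc b) (s≤s h) q        = cong suc (1+a∸b≤1⇒a≡b a b h q)

-- all columns of Y′/X′ lie left of Y′₁, so column a can only be reached by the first row
column-reused : ∀ a X′ Y′ → Linked _≥_ Y′ → first X′ ≤ a → first Y′ ≤ suc a →
  (X′ ≼ʸ Y′) ≡ true → atMostOnePerRow Y′ X′ ≡ true →
  any (a ≡ᵇ_) (skewColumns Y′ X′) ≡ not (first Y′ ≤ᵇ a)
column-reused a X′ []        _  _ _ _ _ = refl
column-reused a X′ (y′ ∷ Y″) lY X₁≤a y′≤1+a fits oneRow with y′ ≤? a
... | yes y′≤a = trans (≡ᵇ-absent a _ (All.map (λ c<y′ → ℕP.<-≤-trans c<y′ y′≤a) (skewColumns-bounded (y′ ∷ Y″) X′ lY)))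
                       (sym (cong not (≤ᵇ-complete y′≤a)))
... | no y′≰a with ℕP.≤-antisym y′≤1+a (ℕP.≰⇒> y′≰a)
...   | refl with 1+a∸b≤1⇒a≡b a (first X′) X₁≤a (≤ᵇ-sound _ 1 (∧-trueˡ oneRow))
...     | refl rewrite columnsFrom-single a | ≡ᵇ-refl a | <ᵇ-irrefl a = refl

1+<⇒1<∸ : ∀ {a y} → suc a < y → 1 < y ∸ a
1+<⇒1<∸ {a} {y} a+1<y = subst (_≤ y ∸ a) (ℕP.m+n∸n≡m 2 a) (ℕP.∸-monoˡ-≤ a a+1<y)

rookᵇ-characterisation : ∀ X Y → Linked _≥_ X → Linked _≥_ Y →
  ((X ≼ʸ Y) ∧ (atMostOnePerRow Y X ∧ noDup (skewColumns Y X))) ≡ rookᵇ X Y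
rookᵇ-characterisation X []       lX lY = BP.∧-identityʳ (null X)
rookᵇ-characterisation X (y ∷ Y′) lX lY with first X ≤? y
... | no X₁≰y rewrite >⇒≤ᵇ-false (ℕP.≰⇒> X₁≰y) = refl
... | yes X₁≤y rewrite ≤ᵇ-complete X₁≤y with y ≤? first X
...   | yes y≤X₁ rewrite columnsFrom-empty (first X) y y≤X₁ | ℕP.m≤n⇒m∸n≡0 y≤X₁
                        | ≤ᵇ-complete (ℕP.≤-trans y≤X₁ (ℕP.n≤1+n (first X)))
                        | ≤ᵇ-complete (ℕP.≤-trans (first≥second (y ∷ Y′) lY) y≤X₁)
  = rookᵇ-characterisation (rest X) Y′ (Linked-rest X lX) (Linked.tail lY)
...   | no y≰X₁ with y ≤? suc (first X)
...     | no y≰1+X₁ rewrite >⇒≤ᵇ-false (1+<⇒1<∸ (ℕP.≰⇒> y≰1+X₁)) | >⇒≤ᵇ-false (ℕP.≰⇒> y≰1+X₁) = BP.∧-zeroʳ ((rest X) ≼ʸ Y′)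
...     | yes y≤1+X₁ with ℕP.≤-antisym y≤1+X₁ (ℕP.≰⇒> y≰X₁)
...       | refl rewrite columnsFrom-single (first X) | ℕP.m+n∸n≡m 1 (first X) | ≤ᵇ-complete (ℕP.≤-refl {suc (first X)}) = newColumn
  where
  a = first X
  X′ = rest X
  IH = rookᵇ-characterisation X′ Y′ (Linked-rest X lX) (Linked.tail lY)
  newColumn : ((X′ ≼ʸ Y′) ∧ (atMostOnePerRow Y′ X′ ∧ (not (any (a ≡ᵇ_) (skewColumns Y′ X′)) ∧ noDup (skewColumns Y′ X′))))
            ≡ ((first Y′ ≤ᵇ a) ∧ rookᵇ X′ Y′)
  newColumn with X′ ≼ʸ Y′ in fits | atMostOnePerRow Y′ X′ in oneRow
  ... | true  | true rewrite column-reused a X′ Y′ (Linked.tail lY) (first≥second X lX) (first≥second (suc a ∷ Y′) lY) fits oneRow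
    = cong₂ _∧_ (BP.not-involutive _) (trans (sym (cong₂ (λ u v → u ∧ (v ∧ noDup (skewColumns Y′ X′))) fits oneRow)) IH)
  ... | false | _    = sym (trans (cong ((first Y′ ≤ᵇ a) ∧_) (trans (sym IH) (cong (λ u → u ∧ (atMostOnePerRow Y′ X′ ∧ noDup (skewColumns Y′ X′))) fits))) (BP.∧-zeroʳ _))
  ... | true  | false = sym (trans (cong ((first Y′ ≤ᵇ a) ∧_) (trans (sym IH) (cong₂ (λ u v → u ∧ (v ∧ noDup (skewColumns Y′ X′))) fits oneRow))) (BP.∧-zeroʳ _))

a₂ᴸ-rookᵇ : ∀ X Y → IsPartition X → IsPartition Y → a₂ᴸ X Y ≡ ι (rookᵇ X Y ∧ not (eqList X Y))
a₂ᴸ-rookᵇ X Y (lX , posX) (lY , _) = cong ι (begin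
  ((X ⊆ᴸ Y) ∧ not (eqList X Y)) ∧ isRookStrip (skewᴸ Y X)
    ≡⟨ cong₂ (λ u v → (u ∧ not (eqList X Y)) ∧ v) (trans (⊆ᴸ≡≼ X Y) (≼≡≼ʸ X Y posX))
             (cong₂ _∧_ (rows-skewᴸ Y X) (cong noDup (columns-skewᴸ Y X))) ⟩
  ((X ≼ʸ Y) ∧ not (eqList X Y)) ∧ (atMostOnePerRow Y X ∧ noDup (skewColumns Y X))
    ≡⟨ ∧-swapʳ (X ≼ʸ Y) (not (eqList X Y)) _ ⟩
  ((X ≼ʸ Y) ∧ (atMostOnePerRow Y X ∧ noDup (skewColumns Y X))) ∧ not (eqList X Y)
    ≡⟨ cong (_∧ not (eqList X Y)) (rookᵇ-characterisation X Y lX lY) ⟩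
  rookᵇ X Y ∧ not (eqList X Y) ∎)
  where
  open ≡-Reasoning
  ∧-swapʳ : ∀ a b c → ((a ∧ b) ∧ c) ≡ ((a ∧ c) ∧ b)
  ∧-swapʳ true  b c = BP.∧-comm b c
  ∧-swapʳ false b c = refl

≼∧emptySkew≡eqList : ∀ X Y → IsPartition X → IsPartition Y → ((X ≼ Y) ∧ (skewSize Y X ≡ᵇ 0)) ≡ eqList X Y
≼∧emptySkew≡eqList []      []      _ _ = refl
≼∧emptySkew≡eqList []      (y ∷ Y) _ (_ , 1≤y ∷ _) with y
... | suc _ = refl
≼∧emptySkew≡eqList (x ∷ X) []      (_ , 1≤x ∷ _) _ rewrite >⇒≤ᵇ-false 1≤x = refl
≼∧emptySkew≡eqList (x ∷ X) (y ∷ Y) isX isY with <-cmp x y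
... | tri< x<y _ _ rewrite ≤ᵇ-complete (ℕP.<⇒≤ x<y) | ℕP.+-∸-assoc 1 x<y | <⇒≡ᵇ-false x<y = BP.∧-zeroʳ (X ≼ Y)
... | tri≈ _ refl _ rewrite ≤ᵇ-complete (ℕP.≤-refl {x}) | ℕP.n∸n≡0 x | ≡ᵇ-refl x =
  ≼∧emptySkew≡eqList X Y (IsPartition-rest (x ∷ X) isX) (IsPartition-rest (y ∷ Y) isY)
... | tri> _ _ y<x rewrite >⇒≤ᵇ-false y<x | >⇒≡ᵇ-false y<x = refl

extendBy : ℕ → List (List ℕ) → List (List ℕ)
extendBy x []      = []
extendBy x (l ∷ L) = if first l ≤ᵇ x then (x ∷ l) ∷ extendBy x L else extendBy x L

upCovers : List ℕ → List (List ℕ)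
upCovers []      = (1 ∷ []) ∷ []
upCovers (x ∷ X) = (suc x ∷ X) ∷ extendBy x (upCovers X)

shrinkFirst : ℕ → List ℕ → List ℕ
shrinkFirst (suc (suc k)) P = suc k ∷ P
shrinkFirst _             P = P

downCovers : List ℕ → List (List ℕ)
downCovers []      = []
downCovers (p ∷ P) =
  if first P <ᵇ p then shrinkFirst p P ∷ map (p ∷_) (downCovers P) else map (p ∷_) (downCovers P)

occurrences : List ℕ → List (List ℕ) → ℕ
occurrences Y = count (λ l → eqList l Y)

occurrences-extendBy : ∀ x y Y′ L → first Y′ ≤ y → occurrences (y ∷ Y′) (extendBy x L) ≡ ι (x ≡ᵇ y) * occurrences Y′ L
occurrences-extendBy x y Y′ []      _     = sym (ℕP.*-zeroʳ (ι (x ≡ᵇ y)))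
occurrences-extendBy x y Y′ (l ∷ L) Y′₁≤y with first l ≤ᵇ x in l₁≤x
... | true  = trans (cong₂ _+_ (ι-∧ (x ≡ᵇ y) (eqList l Y′)) (occurrences-extendBy x y Y′ L Y′₁≤y))
                    (sym (ℕP.*-distribˡ-+ (ι (x ≡ᵇ y)) (ι (eqList l Y′)) (occurrences Y′ L)))
... | false = trans (occurrences-extendBy x y Y′ L Y′₁≤y)
                    (trans (cong (_+ ι (x ≡ᵇ y) * occurrences Y′ L) (sym notThere))
                           (sym (ℕP.*-distribˡ-+ (ι (x ≡ᵇ y)) (ι (eqList l Y′)) (occurrences Y′ L))))
  where
  notThere : ι (x ≡ᵇ y) * ι (eqList l Y′) ≡ 0
  notThere with x ≡ᵇ y in x≟y | eqList l Y′ in l≟Y′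
  ... | false | _     = refl
  ... | true  | false = refl
  ... | true  | true  = ⊥-elim (subst T l₁≤x (ℕP.≤⇒≤ᵇ
        (subst (λ t → first t ≤ x) (sym (eqList⇒≡ l Y′ l≟Y′)) (subst (first Y′ ≤_) (sym (≡ᵇ-sound x y x≟y)) Y′₁≤y))))

occurrences-extendBy-[] : ∀ x L → occurrences [] (extendBy x L) ≡ 0
occurrences-extendBy-[] x []      = refl
occurrences-extendBy-[] x (l ∷ L) with first l ≤ᵇ x
... | true  = occurrences-extendBy-[] x L
... | false = occurrences-extendBy-[] x L

skewSize-[] : ∀ Y → skewSize Y [] ≡ sum Y
skewSize-[] []      = refl
skewSize-[] (y ∷ Y) = cong (y +_) (skewSize-[] Y)

occurrences-upCovers : ∀ X Y → IsPartition X → IsPartition Y →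
  occurrences Y (upCovers X) ≡ ι ((X ≼ Y) ∧ (skewSize Y X ≡ᵇ 1))
occurrences-upCovers []       Y       _ isY = trans (ℕP.+-identityʳ _) (cong ι (trans (single Y isY) (cong (_≡ᵇ 1) (sym (skewSize-[] Y)))))
  where
  single : ∀ Y → IsPartition Y → eqList (1 ∷ []) Y ≡ (sum Y ≡ᵇ 1)
  single []               _                         = refl
  single (zero ∷ [])      _                         = refl
  single (suc zero ∷ [])  _                         = refl
  single (suc (suc y) ∷ []) _                       = refl
  single (y ∷ y₂ ∷ Y)     (_ , 1≤y ∷ 1≤y₂ ∷ _) with y | y₂ | 1≤y | 1≤y₂
  ... | suc zero    | suc _ | _ | _ = refl
  ... | suc (suc _) | suc _ | _ | _ = refl
occurrences-upCovers (x ∷ X′) []       (_ , 1≤x ∷ _) _ rewrite >⇒≤ᵇ-false 1≤x | occurrences-extendBy-[] x (upCovers X′) = refl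
occurrences-upCovers (x ∷ X′) (y ∷ Y′) isX isY with <-cmp x y
... | tri> _ _ y<x rewrite occurrences-extendBy x y Y′ (upCovers X′) (first≥second (y ∷ Y′) (proj₁ isY))
                         | >⇒≤ᵇ-false y<x | >⇒≡ᵇ-false y<x | >⇒≡ᵇ-false (ℕP.m<n⇒m<1+n y<x) = refl
... | tri≈ _ refl _ rewrite occurrences-extendBy x x Y′ (upCovers X′) (first≥second (x ∷ Y′) (proj₁ isY))
                          | ≤ᵇ-complete (ℕP.≤-refl {x}) | ℕP.n∸n≡0 x | >⇒≡ᵇ-false (ℕP.n<1+n x) | ≡ᵇ-refl x
  = trans (ℕP.+-identityʳ _) (occurrences-upCovers X′ Y′ (IsPartition-rest (x ∷ X′) isX) (IsPartition-rest (x ∷ Y′) isY))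
... | tri< x<y _ _ rewrite occurrences-extendBy x y Y′ (upCovers X′) (first≥second (y ∷ Y′) (proj₁ isY))
                         | ≤ᵇ-complete (ℕP.<⇒≤ x<y) | <⇒≡ᵇ-false x<y | ℕP.+-∸-assoc 1 x<y with y ≤? suc x
...   | yes y≤1+x with ℕP.≤-antisym y≤1+x x<y
...     | refl rewrite ℕP.n∸n≡0 (suc x) | ≡ᵇ-refl x
  = trans (ℕP.+-identityʳ _) (cong ι (sym (≼∧emptySkew≡eqList X′ Y′ (IsPartition-rest (x ∷ X′) isX) (IsPartition-rest (y ∷ Y′) isY))))
occurrences-upCovers (x ∷ X′) (y ∷ Y′) isX isY | tri< x<y _ _ | no y≰1+x
  rewrite <⇒≡ᵇ-false {suc x} {y} (ℕP.≰⇒> y≰1+x) | ℕP.+-∸-assoc 1 (ℕP.≰⇒> y≰1+x) | BP.∧-zeroʳ (X′ ≼ Y′) = refl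

occurrences-map-∷ : ∀ p z Z′ L → occurrences (z ∷ Z′) (map (p ∷_) L) ≡ ι (p ≡ᵇ z) * occurrences Z′ L
occurrences-map-∷ p z Z′ L = trans (sumMap-map _ (p ∷_) L) (count-∧ˡ (p ≡ᵇ z) (λ l → eqList l Z′) L)

occurrences-downCovers-∷ : ∀ Z p P′ → occurrences Z (downCovers (p ∷ P′))
  ≡ ι (first P′ <ᵇ p) * ι (eqList (shrinkFirst p P′) Z) + occurrences Z (map (p ∷_) (downCovers P′))
occurrences-downCovers-∷ Z p P′ with first P′ <ᵇ p
... | true  = cong (_+ occurrences Z (map (p ∷_) (downCovers P′))) (sym (ℕP.+-identityʳ _))
... | false = refl

shrinkFirst-eqList : ∀ p P′ z Z′ → IsPartition (p ∷ P′) → 1 ≤ z →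
  ι (first P′ <ᵇ p) * ι (eqList (shrinkFirst p P′) (z ∷ Z′)) ≡ ι (first P′ <ᵇ p) * ι ((ℕ.pred p ≡ᵇ z) ∧ eqList P′ Z′)
shrinkFirst-eqList (suc zero)    []          (suc z) Z′ _                      _  = refl
shrinkFirst-eqList (suc zero)    (suc q ∷ P′) z      Z′ _                      _  = refl
shrinkFirst-eqList (suc (suc k)) P′          z       Z′ _                      _  = refl
shrinkFirst-eqList (suc zero)    (zero ∷ P′) z       Z′ (_ , _ ∷ () ∷ _)      _
shrinkFirst-eqList zero          P′          z       Z′ (_ , () ∷ _)          _

pred[n]<n : ∀ {n} → 1 ≤ n → ℕ.pred n < n
pred[n]<n {suc n} _ = ℕP.≤-refl

1+<⇒< : ∀ {z p} → suc z < p → z < p ∸ 1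
1+<⇒< {z} {suc p} (s≤s z<p) = z<p

occurrences-downCovers : ∀ Z P → IsPartition Z → IsPartition P →
  occurrences Z (downCovers P) ≡ ι ((Z ≼ P) ∧ (skewSize P Z ≡ᵇ 1))
occurrences-downCovers Z        []       _ _ rewrite BP.∧-zeroʳ (Z ≼ []) = refl
occurrences-downCovers []       (p ∷ P′) _ isP
  rewrite occurrences-downCovers-∷ [] p P′ | sumMap-map (λ l → ι (eqList l [])) (p ∷_) (downCovers P′)
        | sumMap-zero (λ _ → 0) (downCovers P′) (All.universal (λ _ → refl) _) | skewSize-[] P′ = single p P′ isP
  where
  single : ∀ p P′ → IsPartition (p ∷ P′) → ι (first P′ <ᵇ p) * ι (eqList (shrinkFirst p P′) []) + 0 ≡ ι (p + sum P′ ≡ᵇ 1)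
  single (suc zero)    []           _                 = refl
  single (suc zero)    (suc q ∷ P′) _                 = refl
  single (suc zero)    (zero ∷ P′)  (_ , _ ∷ () ∷ _)
  single (suc (suc k)) P′           _                 = trans (ℕP.+-identityʳ _) (ℕP.*-zeroʳ (ι (first P′ <ᵇ suc (suc k))))
  single zero          P′           (_ , () ∷ _)
occurrences-downCovers (z ∷ Z′) (p ∷ P′) isZ isP
  rewrite occurrences-downCovers-∷ (z ∷ Z′) p P′ | occurrences-map-∷ p z Z′ (downCovers P′)
        | shrinkFirst-eqList p P′ z Z′ isP (All.head (proj₂ isZ)) with <-cmp z p
... | tri> _ _ p<z rewrite >⇒≤ᵇ-false p<z | <⇒≡ᵇ-false {ℕ.pred p} {z} (ℕP.≤-<-trans (ℕP.pred[n]≤n {p}) p<z) | <⇒≡ᵇ-false p<z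
  = trans (ℕP.+-identityʳ _) (ℕP.*-zeroʳ (ι (first P′ <ᵇ p)))
... | tri≈ _ refl _ rewrite ≤ᵇ-complete (ℕP.≤-refl {z}) | ℕP.n∸n≡0 z | ≡ᵇ-refl z
                          | <⇒≡ᵇ-false {ℕ.pred z} {z} (pred[n]<n (All.head (proj₂ isZ)))
  = trans (cong₂ _+_ (ℕP.*-zeroʳ (ι (first P′ <ᵇ z))) (ℕP.+-identityʳ _))
          (occurrences-downCovers Z′ P′ (IsPartition-rest (z ∷ Z′) isZ) (IsPartition-rest (z ∷ P′) isP))
... | tri< z<p _ _ with p ≤? suc z
...   | yes p≤1+z with ℕP.≤-antisym p≤1+z z<p
...     | refl rewrite ≤ᵇ-complete (ℕP.n≤1+n z) | ≡ᵇ-refl z | >⇒≡ᵇ-false (ℕP.n<1+n z) | ℕP.m+n∸n≡m 1 z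
  = trans (ℕP.+-identityʳ _) (trans (sameRest (eqList P′ Z′) refl)
          (cong ι (sym (≼∧emptySkew≡eqList Z′ P′ (IsPartition-rest (z ∷ Z′) isZ) (IsPartition-rest (suc z ∷ P′) isP)))))
  where
  sameRest : ∀ b → eqList P′ Z′ ≡ b → ι (first P′ <ᵇ suc z) * ι b ≡ ι (eqList Z′ P′)
  sameRest false e = trans (ℕP.*-zeroʳ (ι (first P′ <ᵇ suc z))) (cong ι (sym (trans (eqList-sym Z′ P′) e)))
  sameRest true  e rewrite eqList⇒≡ P′ Z′ e | eqList-refl Z′ | <ᵇ-complete (s≤s (first≥second (z ∷ Z′) (proj₁ isZ))) = refl
occurrences-downCovers (z ∷ Z′) (p ∷ P′) isZ isP | tri< z<p _ _ | no p≰1+z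
  rewrite >⇒≡ᵇ-false {p ∸ 1} {z} (1+<⇒< (ℕP.≰⇒> p≰1+z)) | >⇒≡ᵇ-false z<p | ≤ᵇ-complete (ℕP.<⇒≤ z<p)
        | ℕP.+-∸-assoc 1 z<p | ℕP.+-∸-assoc 1 (ℕP.≰⇒> p≰1+z) | BP.∧-zeroʳ (Z′ ≼ P′)
  = trans (ℕP.+-identityʳ _) (ℕP.*-zeroʳ (ι (first P′ <ᵇ p)))

a₁ᴸ≡ : ∀ X Y → Linked _≥_ X → a₁ᴸ X Y ≡ ι ((X ≼ Y) ∧ (skewSize Y X ≡ᵇ 1)) + ι (eqList X Y) * cornerCount X
a₁ᴸ≡ X Y lX = cong₂ _+_ (cong₂ (λ u n → ι (u ∧ (n ≡ᵇ 1))) (⊆ᴸ≡≼ X Y) (length-skewᴸ Y X)) (loops (eqList X Y))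
  where
  loops : ∀ b → (if b then length (innerCornersᴸ X) else 0) ≡ ι b * cornerCount X
  loops true  = trans (length-innerCornersᴸ X lX) (sym (ℕP.+-identityʳ (cornerCount X)))
  loops false = refl

a₁ᴸ-upCovers : ∀ X Y → IsPartition X → IsPartition Y → a₁ᴸ X Y ≡ occurrences Y (upCovers X) + ι (eqList X Y) * cornerCount X
a₁ᴸ-upCovers X Y isX isY =
  trans (a₁ᴸ≡ X Y (proj₁ isX)) (cong (_+ ι (eqList X Y) * cornerCount X) (sym (occurrences-upCovers X Y isX isY)))

a₁ᴸ-downCovers : ∀ Z P → IsPartition Z → IsPartition P → a₁ᴸ Z P ≡ occurrences Z (downCovers P) + ι (eqList P Z) * cornerCount P
a₁ᴸ-downCovers Z P isZ isP =
  trans (a₁ᴸ≡ Z P (proj₁ isZ)) (cong₂ _+_ (sym (occurrences-downCovers Z P isZ isP)) (loops (eqList Z P) refl))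
  where
  loops : ∀ b → eqList Z P ≡ b → ι b * cornerCount Z ≡ ι (eqList P Z) * cornerCount P
  loops true  e rewrite eqList⇒≡ Z P e | eqList-refl P = refl
  loops false e rewrite eqList-sym P Z | e = refl

rookᵇ-size : ∀ P Y → rookᵇ P Y ≡ true → sum P ≤ sum Y
rookᵇ-size []      []      _ = z≤n
rookᵇ-size P       (y ∷ Y) e = subst (_≤ y + sum Y) (sum-first P)
  (ℕP.+-mono-≤ (≤ᵇ-sound (first P) y (∧-trueˡ e))
               (rookᵇ-size (rest P) Y (∧-trueʳ {first Y ≤ᵇ first P} (∧-trueʳ {y ≤ᵇ suc (first P)} (∧-trueʳ {first P ≤ᵇ y} e)))))
  where
  sum-first : ∀ P → first P + sum (rest P) ≡ sum P
  sum-first []      = refl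
  sum-first (p ∷ P) = refl

a₂ᴸ-size : ∀ P Y → IsPartition P → IsPartition Y → ¬ (sum P ≤ sum Y) → a₂ᴸ P Y ≡ 0
a₂ᴸ-size P Y isP isY P≰Y = trans (a₂ᴸ-rookᵇ P Y isP isY) (noRook (rookᵇ P Y) refl)
  where
  noRook : ∀ b → rookᵇ P Y ≡ b → ι (b ∧ not (eqList P Y)) ≡ 0
  noRook true  e = ⊥-elim (P≰Y (rookᵇ-size P Y e))
  noRook false e = refl

≼-size : ∀ Z P → (Z ≼ P) ≡ true → sum Z + skewSize P Z ≡ sum P
≼-size []       P        _ = skewSize-[] P
≼-size (z ∷ Z′) []       e rewrite ℕP.n≤0⇒n≡0 (≤ᵇ-sound z 0 (∧-trueˡ e)) = ≼-size Z′ [] (∧-trueʳ {z ≤ᵇ 0} e)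
≼-size (z ∷ Z′) (p ∷ P′) e = begin
  z + sum Z′ + ((p ∸ z) + skewSize P′ Z′)    ≡⟨ ℕP.+-assoc z (sum Z′) _ ⟩
  z + (sum Z′ + ((p ∸ z) + skewSize P′ Z′))  ≡⟨ cong (z +_) (ℕP.+-comm (sum Z′) _) ⟩
  z + (((p ∸ z) + skewSize P′ Z′) + sum Z′)  ≡⟨ cong (z +_) (ℕP.+-assoc (p ∸ z) _ _) ⟩
  z + ((p ∸ z) + (skewSize P′ Z′ + sum Z′))  ≡⟨ sym (ℕP.+-assoc z (p ∸ z) _) ⟩
  (z + (p ∸ z)) + (skewSize P′ Z′ + sum Z′)
    ≡⟨ cong₂ _+_ (ℕP.m+[n∸m]≡n (≤ᵇ-sound z p (∧-trueˡ e)))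
                 (trans (ℕP.+-comm (skewSize P′ Z′) (sum Z′)) (≼-size Z′ P′ (∧-trueʳ {z ≤ᵇ p} e))) ⟩
  p + sum P′ ∎
  where open ≡-Reasoning

a₁ᴸ-size : ∀ Z P → IsPartition Z → IsPartition P → ¬ (sum P ≤ suc (sum Z)) → a₁ᴸ Z P ≡ 0
a₁ᴸ-size Z P isZ _ P≰1+Z rewrite a₁ᴸ≡ Z P (proj₁ isZ) = cong₂ _+_ (noAdd (Z ≼ P) refl) (noLoop (eqList Z P) refl)
  where
  noAdd : ∀ b → (Z ≼ P) ≡ b → ι (b ∧ (skewSize P Z ≡ᵇ 1)) ≡ 0
  noAdd false _ = refl
  noAdd true  e with skewSize P Z ≡ᵇ 1 in one
  ... | false = refl
  ... | true  = ⊥-elim (P≰1+Z (ℕP.≤-reflexive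
                  (trans (sym (≼-size Z P e)) (trans (cong (sum Z +_) (≡ᵇ-sound _ 1 one)) (ℕP.+-comm (sum Z) 1)))))
  noLoop : ∀ b → eqList Z P ≡ b → ι b * cornerCount Z ≡ 0
  noLoop false _ = refl
  noLoop true  e = ⊥-elim (P≰1+Z (subst (λ Q → sum Q ≤ suc (sum Z)) (eqList⇒≡ Z P e) (ℕP.n≤1+n _)))

upCovers-sound : ∀ X → IsPartition X → All (λ l → IsPartition l × sum l ≡ suc (sum X)) (upCovers X)
upCovers-sound []       _   = (([-] , s≤s z≤n ∷ []) , refl) ∷ []
upCovers-sound (x ∷ X′) isX =
  (IsPartition-∷ (suc x) X′ (IsPartition-rest (x ∷ X′) isX) (s≤s z≤n) (ℕP.m≤n⇒m≤1+n (first≥second (x ∷ X′) (proj₁ isX))) , refl)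
  ∷ extendBy-sound (upCovers X′) (upCovers-sound X′ (IsPartition-rest (x ∷ X′) isX))
  where
  extendBy-sound : ∀ L → All (λ l → IsPartition l × sum l ≡ suc (sum X′)) L →
                   All (λ l → IsPartition l × sum l ≡ suc (sum (x ∷ X′))) (extendBy x L)
  extendBy-sound []      []                 = []
  extendBy-sound (l ∷ L) ((isl , sl) ∷ ok) with first l ≤ᵇ x in l₁≤x
  ... | true  = (IsPartition-∷ x l isl (All.head (proj₂ isX)) (≤ᵇ-sound _ x l₁≤x) , trans (cong (x +_) sl) (ℕP.+-suc x (sum X′)))
                ∷ extendBy-sound L ok
  ... | false = extendBy-sound L ok

shrinkFirst-first : ∀ p P → first P ≤ p → first (shrinkFirst p P) ≤ p
shrinkFirst-first zero          P P₁≤p = P₁≤p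
shrinkFirst-first (suc zero)    P P₁≤p = P₁≤p
shrinkFirst-first (suc (suc k)) P _    = ℕP.n≤1+n (suc k)

downCovers-first : ∀ P → All (λ l → first l ≤ first P) (downCovers P)
downCovers-first []      = []
downCovers-first (p ∷ P) with first P <ᵇ p in P₁<p
... | true  = shrinkFirst-first p P (ℕP.<⇒≤ (≤ᵇ-sound (suc (first P)) p P₁<p)) ∷ map⁺ (All.universal (λ _ → ℕP.≤-refl) _)
... | false = map⁺ (All.universal (λ _ → ℕP.≤-refl) _)

map-∷-sound : ∀ p P′ L → IsPartition (p ∷ P′) →
  All (λ l → IsPartition l × suc (sum l) ≡ sum P′) L → All (λ l → first l ≤ first P′) L →
  All (λ l → IsPartition l × suc (sum l) ≡ p + sum P′) (map (p ∷_) L)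
map-∷-sound p P′ L isP ok bounded = map⁺ (All.zipWith extend (ok , bounded))
  where
  extend : ∀ {l} → (IsPartition l × suc (sum l) ≡ sum P′) × first l ≤ first P′ →
           IsPartition (p ∷ l) × suc (sum (p ∷ l)) ≡ p + sum P′
  extend ((isl , sl) , l₁≤P′₁) =
      IsPartition-∷ p _ isl (All.head (proj₂ isP)) (ℕP.≤-trans l₁≤P′₁ (first≥second (p ∷ P′) (proj₁ isP)))
    , trans (sym (ℕP.+-suc p _)) (cong (p +_) sl)

shrinkFirst-sound : ∀ p P′ → IsPartition (p ∷ P′) → (first P′ <ᵇ p) ≡ true →
                    IsPartition (shrinkFirst p P′) × suc (sum (shrinkFirst p P′)) ≡ p + sum P′
shrinkFirst-sound (suc zero)    []       _                  _ = ([] , []) , refl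
shrinkFirst-sound (suc zero)    (q ∷ P′) (_ , _ ∷ 1≤q ∷ _) e = ⊥-elim (ℕP.<-irrefl refl (ℕP.<-≤-trans (≤ᵇ-sound (suc q) 1 e) 1≤q))
shrinkFirst-sound (suc (suc k)) P′       isP                e =
    IsPartition-∷ (suc k) P′ (IsPartition-rest (suc (suc k) ∷ P′) isP) (s≤s z≤n) (ℕP.≤-pred (≤ᵇ-sound (suc (first P′)) (suc (suc k)) e))
  , refl
shrinkFirst-sound zero          P′       (_ , () ∷ _)       _

downCovers-sound : ∀ P → IsPartition P → All (λ l → IsPartition l × suc (sum l) ≡ sum P) (downCovers P)
downCovers-sound []       _   = []
downCovers-sound (p ∷ P′) isP with first P′ <ᵇ p in P′₁<p
... | true  = shrinkFirst-sound p P′ isP P′₁<p ∷ map-∷-sound p P′ _ isP (downCovers-sound P′ (IsPartition-rest (p ∷ P′) isP)) (downCovers-first P′)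
... | false = map-∷-sound p P′ _ isP (downCovers-sound P′ (IsPartition-rest (p ∷ P′) isP)) (downCovers-first P′)

rook : List ℕ → List ℕ → ℕ
rook P Y = ι (rookᵇ P Y)

upRookSum : List ℕ → List ℕ → ℕ
upRookSum P X = sumMap (rook P) (upCovers X)

downRookSum : List ℕ → List ℕ → ℕ
downRookSum P X = sumMap (λ l → rook l X) (downCovers P)

-- lowerUpCovers X: the covers of X adding a box below the first row
growFirst : List ℕ → List ℕ
growFirst X = suc (first X) ∷ rest X

lowerUpCovers : List ℕ → List (List ℕ)
lowerUpCovers []      = []
lowerUpCovers (x ∷ X) = extendBy x (upCovers X)

upCovers-split : ∀ X → upCovers X ≡ growFirst X ∷ lowerUpCovers X
upCovers-split []      = refl
upCovers-split (x ∷ X) = refl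

lowerUpCovers-first : ∀ X → All (λ l → first l ≡ first X) (lowerUpCovers X)
lowerUpCovers-first []      = []
lowerUpCovers-first (x ∷ X) = extendBy-first (upCovers X)
  where
  extendBy-first : ∀ L → All (λ l → first l ≡ x) (extendBy x L)
  extendBy-first []      = []
  extendBy-first (l ∷ L) with first l ≤ᵇ x
  ... | true  = refl ∷ extendBy-first L
  ... | false = extendBy-first L

lowerRookSum : List ℕ → List ℕ → ℕ
lowerRookSum P X = sumMap (rook P) (lowerUpCovers X)

cappedUpRookSum : ℕ → List ℕ → List ℕ → ℕ
cappedUpRookSum t P X = sumMap (λ l → ι ((first l ≤ᵇ t) ∧ rookᵇ P l)) (upCovers X)

cappedUpRookSum-split : ∀ t P X →
  cappedUpRookSum t P X ≡ ι ((suc (first X) ≤ᵇ t) ∧ rookᵇ P (growFirst X)) + ι (first X ≤ᵇ t) * lowerRookSum P X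
cappedUpRookSum-split t P X rewrite upCovers-split X =
  cong (ι ((suc (first X) ≤ᵇ t) ∧ rookᵇ P (growFirst X)) +_) (sameFirst (lowerUpCovers X) (lowerUpCovers-first X))
  where
  sameFirst : ∀ L → All (λ l → first l ≡ first X) L →
              sumMap (λ l → ι ((first l ≤ᵇ t) ∧ rookᵇ P l)) L ≡ ι (first X ≤ᵇ t) * sumMap (rook P) L
  sameFirst L eqs = trans (sumMap-cong _ _ L (λ l → ι-∧ (first l ≤ᵇ t) (rookᵇ P l)))
    (trans (sumMap-congᴬ _ _ L (All.map (λ e → cong (λ h → ι (h ≤ᵇ t) * _) e) eqs)) (sumMap-*ˡ (ι (first X ≤ᵇ t)) (rook P) L))

upRookSum-split : ∀ P X → upRookSum P X ≡ rook P (growFirst X) + lowerRookSum P X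
upRookSum-split P X rewrite upCovers-split X = refl

upRookSum-∷ : ∀ P x X′ → upRookSum P (x ∷ X′)
  ≡ rook P (suc x ∷ X′) + ι ((first P ≤ᵇ x) ∧ (x ≤ᵇ suc (first P))) * cappedUpRookSum (first P) (rest P) X′
upRookSum-∷ P x X′ = cong (rook P (suc x ∷ X′) +_) (begin
  sumMap (rook P) (extendBy x (upCovers X′))
    ≡⟨ sumMap-extendBy (rook P) (upCovers X′) ⟩
  sumMap (λ l → ι (first l ≤ᵇ x) * rook P (x ∷ l)) (upCovers X′)
    ≡⟨ sumMap-cong _ _ (upCovers X′) regroup ⟩
  sumMap (λ l → c * ι ((first l ≤ᵇ first P) ∧ rookᵇ (rest P) l)) (upCovers X′)
    ≡⟨ sumMap-*ˡ c (λ l → ι ((first l ≤ᵇ first P) ∧ rookᵇ (rest P) l)) (upCovers X′) ⟩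
  c * cappedUpRookSum (first P) (rest P) X′ ∎)
  where
  open ≡-Reasoning
  c = ι ((first P ≤ᵇ x) ∧ (x ≤ᵇ suc (first P)))
  sumMap-extendBy : ∀ f L → sumMap f (extendBy x L) ≡ sumMap (λ l → ι (first l ≤ᵇ x) * f (x ∷ l)) L
  sumMap-extendBy f []      = refl
  sumMap-extendBy f (l ∷ L) with first l ≤ᵇ x
  ... | true  = cong₂ _+_ (sym (ℕP.+-identityʳ (f (x ∷ l)))) (sumMap-extendBy f L)
  ... | false = sumMap-extendBy f L
  -- the guard first l ≤ x is implied by first l ≤ first P ≤ x
  absorb : ∀ b₁ b₂ b₃ b₄ r → (b₂ ≡ true → b₄ ≡ true → b₁ ≡ true) → (b₁ ∧ (b₂ ∧ (b₃ ∧ (b₄ ∧ r)))) ≡ ((b₂ ∧ b₃) ∧ (b₄ ∧ r))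
  absorb true  true  b₃ b₄    r h = refl
  absorb b₁    false b₃ b₄    r h = BP.∧-zeroʳ b₁
  absorb false true  b₃ false r h = sym (BP.∧-zeroʳ b₃)
  absorb false true  b₃ true  r h with h refl refl
  ... | ()
  regroup : ∀ l → ι (first l ≤ᵇ x) * rook P (x ∷ l) ≡ c * ι ((first l ≤ᵇ first P) ∧ rookᵇ (rest P) l)
  regroup l = trans (sym (ι-∧ (first l ≤ᵇ x) (rookᵇ P (x ∷ l))))
    (trans (cong ι (absorb (first l ≤ᵇ x) (first P ≤ᵇ x) (x ≤ᵇ suc (first P)) (first l ≤ᵇ first P) (rookᵇ (rest P) l)
                           (λ P₁≤x l₁≤P₁ → ≤ᵇ-complete (ℕP.≤-trans (≤ᵇ-sound (first l) (first P) l₁≤P₁) (≤ᵇ-sound (first P) x P₁≤x)))))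
           (ι-∧ ((first P ≤ᵇ x) ∧ (x ≤ᵇ suc (first P))) ((first l ≤ᵇ first P) ∧ rookᵇ (rest P) l)))

count-downCovers-∷ : ∀ (g : List ℕ → Bool) p P′ → count g (downCovers (p ∷ P′))
  ≡ ι ((first P′ <ᵇ p) ∧ g (shrinkFirst p P′)) + count (λ l → g (p ∷ l)) (downCovers P′)
count-downCovers-∷ g p P′ with first P′ <ᵇ p
... | true  = cong (ι (g (shrinkFirst p P′)) +_) (sumMap-map _ (p ∷_) (downCovers P′))
... | false = sumMap-map _ (p ∷_) (downCovers P′)

downRookSum-∷ : ∀ p P′ x X′ → downRookSum (p ∷ P′) (x ∷ X′)
  ≡ ι ((first P′ <ᵇ p) ∧ rookᵇ (shrinkFirst p P′) (x ∷ X′)) + ι ((p ≤ᵇ x) ∧ ((x ≤ᵇ suc p) ∧ (first X′ ≤ᵇ p))) * downRookSum P′ X′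
downRookSum-∷ p P′ x X′ = trans (count-downCovers-∷ (λ l → rookᵇ l (x ∷ X′)) p P′)
  (cong (ι ((first P′ <ᵇ p) ∧ rookᵇ (shrinkFirst p P′) (x ∷ X′)) +_)
        (trans (sumMap-cong _ _ (downCovers P′) (λ l → trans (cong ι (∧-reassoc (p ≤ᵇ x) (x ≤ᵇ suc p) (first X′ ≤ᵇ p) (rookᵇ l X′))) (ι-∧ c (rookᵇ l X′))))
               (sumMap-*ˡ (ι c) (λ l → rook l X′) (downCovers P′))))
  where
  c = (p ≤ᵇ x) ∧ ((x ≤ᵇ suc p) ∧ (first X′ ≤ᵇ p))
  ∧-reassoc : ∀ a b d r → (a ∧ (b ∧ (d ∧ r))) ≡ ((a ∧ (b ∧ d)) ∧ r)
  ∧-reassoc true  true  true  r = refl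
  ∧-reassoc true  true  false r = refl
  ∧-reassoc true  false d     r = refl
  ∧-reassoc false b     d     r = refl

rookᵇ-shrinkFirst : ∀ p P′ x X′ → IsPartition (p ∷ P′) → ((first P′ <ᵇ p) ∧ rookᵇ (shrinkFirst p P′) (x ∷ X′))
  ≡ ((first P′ <ᵇ p) ∧ ((p ≤ᵇ suc x) ∧ ((x ≤ᵇ p) ∧ ((first X′ <ᵇ p) ∧ rookᵇ P′ X′))))
rookᵇ-shrinkFirst (suc zero) [] x X′ _ rewrite sym (≤ᵇ⇔<ᵇ-suc 0 x) =
  cong (λ b → (0 ≤ᵇ x) ∧ ((x ≤ᵇ 1) ∧ (b ∧ rookᵇ [] X′))) (≤ᵇ⇔<ᵇ-suc (first X′) 0)
rookᵇ-shrinkFirst (suc zero) (q ∷ P′) x X′ (_ , _ ∷ 1≤q ∷ _) rewrite >⇒≤ᵇ-false {suc q} {1} (s≤s 1≤q) = refl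
rookᵇ-shrinkFirst (suc (suc k)) P′ x X′ _ =
  cong ((first P′ <ᵇ suc (suc k)) ∧_)
       (cong₂ (λ u v → u ∧ ((x ≤ᵇ suc (suc k)) ∧ (v ∧ rookᵇ P′ X′))) (≤ᵇ⇔<ᵇ-suc (suc k) x) (≤ᵇ⇔<ᵇ-suc (first X′) (suc k)))
rookᵇ-shrinkFirst zero P′ x X′ (_ , () ∷ _)

rookᵇ-first≤ : ∀ P Y → rookᵇ P Y ≡ true → first P ≤ first Y
rookᵇ-first≤ []      []      _ = z≤n
rookᵇ-first≤ P       (y ∷ Y) e = ≤ᵇ-sound (first P) y (∧-trueˡ e)

rookᵇ-first≤suc : ∀ P Y → rookᵇ P Y ≡ true → first Y ≤ suc (first P)
rookᵇ-first≤suc P []      _ = z≤n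
rookᵇ-first≤suc P (y ∷ Y) e = ≤ᵇ-sound y (suc (first P)) (∧-trueˡ (∧-trueʳ {first P ≤ᵇ y} e))

rookᵇ-growFirst : ∀ P′ X′ → 1 ≤ first X′ → first P′ ≡ first X′ → rookᵇ P′ (growFirst X′) ≡ rookᵇ P′ X′
rookᵇ-growFirst P′ (h ∷ X″) _ e
  rewrite e | ≤ᵇ-complete (ℕP.n≤1+n h) | ≤ᵇ-complete (ℕP.≤-refl {h}) | ≤ᵇ-complete (ℕP.≤-refl {suc h}) = refl

-- exactly one summand on the right survives, according to whether P′₁ = p or P′₁ < p
rook-first-row-full : ∀ p P′ X′ → first X′ ≡ p → 1 ≤ p → first P′ ≤ p →
  rook P′ X′ ≡ rook P′ (growFirst X′) + ι (first P′ <ᵇ p) * rook P′ X′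
rook-first-row-full p P′ X′ X′₁≡p 1≤p P′₁≤p with first P′ <? p
... | yes P′₁<p rewrite <ᵇ-complete P′₁<p = trans (sym (ℕP.+-identityʳ (rook P′ X′))) (cong (_+ (rook P′ X′ + 0)) (sym noGrowth))
  where
  noGrowth : rook P′ (growFirst X′) ≡ 0
  noGrowth with rookᵇ P′ (growFirst X′) in e
  ... | false = refl
  ... | true  = ⊥-elim (ℕP.<-irrefl refl (ℕP.<-≤-trans (subst (first P′ <_) (sym X′₁≡p) P′₁<p) (ℕP.≤-pred (rookᵇ-first≤suc P′ (growFirst X′) e))))
... | no P′₁≮p rewrite rookᵇ-growFirst P′ X′ (subst (1 ≤_) (sym X′₁≡p) 1≤p) (trans (ℕP.≤-antisym P′₁≤p (ℕP.≮⇒≥ P′₁≮p)) (sym X′₁≡p))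
                     | ℕP.≤-antisym P′₁≤p (ℕP.≮⇒≥ P′₁≮p) | <ᵇ-irrefl p = sym (ℕP.+-identityʳ _)

rook-guarded : ∀ p P′ X′ → first X′ < p → rook P′ X′ ≡ ι (first P′ <ᵇ p) * rook P′ X′
rook-guarded p P′ X′ X′₁<p with rookᵇ P′ X′ in e
... | false = sym (ℕP.*-zeroʳ (ι (first P′ <ᵇ p)))
... | true rewrite <ᵇ-complete (ℕP.≤-<-trans (rookᵇ-first≤ P′ X′ e) X′₁<p) = refl

commute-x<p : ∀ r h → r ≡ h * r → r + 0 + 0 ≡ h * r + 0 + 0 + 0
commute-x<p r h f = trans (l r) (trans f (sym (l' (h * r))))
  where l : ∀ r → r + 0 + 0 ≡ r
        l = ℕ-Solver.solve-∀
        l' : ∀ t → t + 0 + 0 + 0 ≡ t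
        l' = ℕ-Solver.solve-∀

commute-x≡p-X′₁<x : ∀ r h j W Dd cX′ cP′ → j + W + cX′ * r ≡ Dd + cP′ * r + r → r ≡ h * r →
  r + ((j + (W + 0)) + 0) + (1 + cX′) * r ≡ h * r + (Dd + 0) + (h + cP′) * r + r
commute-x≡p-X′₁<x r h j W Dd cX′ cP′ ih f = begin
  r + ((j + (W + 0)) + 0) + (1 + cX′) * r ≡⟨ l1 r j W cX′ ⟩
  r + r + (j + W + cX′ * r) ≡⟨ cong (r + r +_) ih ⟩
  r + r + (Dd + cP′ * r + r) ≡⟨ cong₂ (λ u v → u + v + (Dd + cP′ * r + r)) f f ⟩
  h * r + h * r + (Dd + cP′ * r + r) ≡⟨ l2 r h Dd cP′ ⟩
  h * r + (Dd + 0) + (h + cP′) * r + r ∎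
  where open ≡-Reasoning
        l1 : ∀ r j W cX′ → r + ((j + (W + 0)) + 0) + (1 + cX′) * r ≡ r + r + (j + W + cX′ * r)
        l1 = ℕ-Solver.solve-∀
        l2 : ∀ r h Dd cP′ → h * r + h * r + (Dd + cP′ * r + r) ≡ h * r + (Dd + 0) + (h + cP′) * r + r
        l2 = ℕ-Solver.solve-∀

commute-x≡p-X′₁≡x : ∀ r h j W Dd cX′ cP′ → j + W + cX′ * r ≡ Dd + cP′ * r + r → r ≡ j + h * r →
  r + ((0 + (W + 0)) + 0) + (0 + cX′) * r ≡ 0 + (Dd + 0) + (h + cP′) * r + r
commute-x≡p-X′₁≡x r h j W Dd cX′ cP′ ih f = begin
  r + ((0 + (W + 0)) + 0) + (0 + cX′) * r ≡⟨ l1 r W cX′ ⟩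
  r + W + cX′ * r ≡⟨ cong (λ t → t + W + cX′ * r) f ⟩
  j + h * r + W + cX′ * r ≡⟨ l2 j h r W cX′ ⟩
  h * r + (j + W + cX′ * r) ≡⟨ cong (h * r +_) ih ⟩
  h * r + (Dd + cP′ * r + r) ≡⟨ l3 h r Dd cP′ ⟩
  0 + (Dd + 0) + (h + cP′) * r + r ∎
  where open ≡-Reasoning
        l1 : ∀ r W cX′ → r + ((0 + (W + 0)) + 0) + (0 + cX′) * r ≡ r + W + cX′ * r
        l1 = ℕ-Solver.solve-∀
        l2 : ∀ j h r W cX′ → j + h * r + W + cX′ * r ≡ h * r + (j + W + cX′ * r)
        l2 = ℕ-Solver.solve-∀
        l3 : ∀ h r Dd cP′ → h * r + (Dd + cP′ * r + r) ≡ 0 + (Dd + 0) + (h + cP′) * r + r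
        l3 = ℕ-Solver.solve-∀

commute-x≡1+p-X′₁<p : ∀ r h j W Dd cX′ cP′ → j + W + cX′ * r ≡ Dd + cP′ * r + r → r ≡ h * r →
  j + 1 * W + 0 + (1 + cX′) * r ≡ 0 + 1 * Dd + (h + cP′) * r + r
commute-x≡1+p-X′₁<p r h j W Dd cX′ cP′ ih f = begin
  j + 1 * W + 0 + (1 + cX′) * r ≡⟨ l1 j W cX′ r ⟩
  (j + W + cX′ * r) + r ≡⟨ cong (_+ r) ih ⟩
  Dd + cP′ * r + r + r ≡⟨ cong (λ t → Dd + cP′ * r + r + t) f ⟩
  Dd + cP′ * r + r + h * r ≡⟨ l2 Dd cP′ r h ⟩
  0 + 1 * Dd + (h + cP′) * r + r ∎
  where open ≡-Reasoning
        l1 : ∀ j W cX′ r → j + 1 * W + 0 + (1 + cX′) * r ≡ (j + W + cX′ * r) + r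
        l1 = ℕ-Solver.solve-∀
        l2 : ∀ Dd cP′ r h → Dd + cP′ * r + r + h * r ≡ 0 + 1 * Dd + (h + cP′) * r + r
        l2 = ℕ-Solver.solve-∀

commute-x≡1+p-X′₁≡p : ∀ r h j W Dd cX′ cP′ → j + W + cX′ * r ≡ Dd + cP′ * r + r → r ≡ j + h * r →
  0 + 1 * W + 0 + (1 + cX′) * r ≡ 0 + 1 * Dd + (h + cP′) * r + r
commute-x≡1+p-X′₁≡p r h j W Dd cX′ cP′ ih f = begin
  0 + 1 * W + 0 + (1 + cX′) * r ≡⟨ l1 W cX′ r ⟩
  r + W + cX′ * r ≡⟨ cong (λ t → t + W + cX′ * r) f ⟩
  j + h * r + W + cX′ * r ≡⟨ l2 j h r W cX′ ⟩
  h * r + (j + W + cX′ * r) ≡⟨ cong (h * r +_) ih ⟩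
  h * r + (Dd + cP′ * r + r) ≡⟨ l3 h r Dd cP′ ⟩
  0 + 1 * Dd + (h + cP′) * r + r ∎
  where open ≡-Reasoning
        l1 : ∀ W cX′ r → 0 + 1 * W + 0 + (1 + cX′) * r ≡ r + W + cX′ * r
        l1 = ℕ-Solver.solve-∀
        l2 : ∀ j h r W cX′ → j + h * r + W + cX′ * r ≡ h * r + (j + W + cX′ * r)
        l2 = ℕ-Solver.solve-∀
        l3 : ∀ h r Dd cP′ → h * r + (Dd + cP′ * r + r) ≡ 0 + 1 * Dd + (h + cP′) * r + r
        l3 = ℕ-Solver.solve-∀

-- the coefficient of P in D′ U X = U D′ X + D′ X for D′ = D + I, whose matrix is rook
RookCommutation : List ℕ → List ℕ → Set
RookCommutation P X = upRookSum P X + cornerCount X * rook P X ≡ downRookSum P X + cornerCount P * rook P X + rook P X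

rook-commutation-∷ : ∀ p P′ x X′ → IsPartition (p ∷ P′) → IsPartition (x ∷ X′) →
  rook P′ (growFirst X′) + lowerRookSum P′ X′ + cornerCount X′ * rook P′ X′ ≡ downRookSum P′ X′ + cornerCount P′ * rook P′ X′ + rook P′ X′ →
  RookCommutation (p ∷ P′) (x ∷ X′)
rook-commutation-∷ p P′ x X′ isP isX ih
  rewrite upRookSum-∷ (p ∷ P′) x X′ | cappedUpRookSum-split p P′ X′ | downRookSum-∷ p P′ x X′ | rookᵇ-shrinkFirst p P′ x X′ isP
  with <-cmp x p
... | tri≈ _ refl _ rewrite ≤ᵇ-complete (ℕP.n≤1+n x) | ≤ᵇ-complete (ℕP.≤-refl {suc x}) | ≤ᵇ-complete (ℕP.≤-refl {x})
                          | ≤ᵇ-complete (first≥second (x ∷ X′) (proj₁ isX)) with first X′ <? x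
...   | yes X′₁<x rewrite <ᵇ-complete X′₁<x | ι-∧ (first P′ <ᵇ x) (rookᵇ P′ X′) =
  commute-x≡p-X′₁<x (rook P′ X′) (ι (first P′ <ᵇ x)) (rook P′ (growFirst X′)) (lowerRookSum P′ X′) (downRookSum P′ X′) (cornerCount X′) (cornerCount P′) ih (rook-guarded x P′ X′ X′₁<x)
...   | no X′₁≮x rewrite ≮⇒<ᵇ-false X′₁≮x | BP.∧-zeroʳ (first P′ <ᵇ x) =
  commute-x≡p-X′₁≡x (rook P′ X′) (ι (first P′ <ᵇ x)) (rook P′ (growFirst X′)) (lowerRookSum P′ X′) (downRookSum P′ X′) (cornerCount X′) (cornerCount P′) ih
    (rook-first-row-full x P′ X′ (ℕP.≤-antisym (first≥second (x ∷ X′) (proj₁ isX)) (ℕP.≮⇒≥ X′₁≮x))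
                         (All.head (proj₂ isP)) (first≥second (x ∷ P′) (proj₁ isP)))
rook-commutation-∷ p P′ x X′ isP isX ih | tri< x<p _ _ with suc x <? p
... | yes 1+x<p rewrite >⇒≤ᵇ-false 1+x<p | >⇒≤ᵇ-false x<p | BP.∧-zeroʳ (first P′ <ᵇ p)
                      | ℕP.*-zeroʳ (ι (first X′ <ᵇ x) + cornerCount X′) | ℕP.*-zeroʳ (ι (first P′ <ᵇ p) + cornerCount P′) = refl
... | no 1+x≮p rewrite ≤ᵇ-complete (ℕP.≮⇒≥ 1+x≮p) | >⇒≤ᵇ-false x<p | <ᵇ-complete (ℕP.m<n⇒m<1+n x<p) | ≤ᵇ-complete (ℕP.<⇒≤ x<p)
                     | ≤ᵇ-complete (ℕP.≤-trans (first≥second (x ∷ X′) (proj₁ isX)) (ℕP.<⇒≤ x<p))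
                     | <ᵇ-complete (ℕP.≤-<-trans (first≥second (x ∷ X′) (proj₁ isX)) x<p) | ι-∧ (first P′ <ᵇ p) (rookᵇ P′ X′)
                     | ℕP.*-zeroʳ (ι (first X′ <ᵇ x) + cornerCount X′) | ℕP.*-zeroʳ (ι (first P′ <ᵇ p) + cornerCount P′) =
  commute-x<p (rook P′ X′) (ι (first P′ <ᵇ p)) (rook-guarded p P′ X′ (ℕP.≤-<-trans (first≥second (x ∷ X′) (proj₁ isX)) x<p))
rook-commutation-∷ p P′ x X′ isP isX ih | tri> _ _ p<x with x ≤? suc p
... | no x≰1+p rewrite ≤ᵇ-complete (ℕP.<⇒≤ p<x) | ≤ᵇ-complete (ℕP.≤-trans (ℕP.<⇒≤ p<x) (ℕP.n≤1+n x))
                     | ≮⇒<ᵇ-false {x} {suc p} (λ x<1+p → x≰1+p (ℕP.<⇒≤ x<1+p)) | >⇒≤ᵇ-false (ℕP.≰⇒> x≰1+p) | >⇒≤ᵇ-false p<x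
                     | BP.∧-zeroʳ (first P′ <ᵇ p)
                     | ℕP.*-zeroʳ (ι (first X′ <ᵇ x) + cornerCount X′) | ℕP.*-zeroʳ (ι (first P′ <ᵇ p) + cornerCount P′) = refl
... | yes x≤1+p rewrite ≤ᵇ-complete (ℕP.<⇒≤ p<x) | ≤ᵇ-complete (ℕP.≤-trans (ℕP.<⇒≤ p<x) (ℕP.n≤1+n x))
                      | ≮⇒<ᵇ-false {x} {suc p} (λ x<1+p → ℕP.<-irrefl refl (ℕP.<-≤-trans p<x (ℕP.≤-pred x<1+p)))
                      | ≤ᵇ-complete x≤1+p | >⇒≤ᵇ-false p<x with first X′ ≤? p
...   | no X′₁≰p rewrite >⇒≤ᵇ-false (ℕP.≰⇒> X′₁≰p) | ≮⇒<ᵇ-false {first X′} {p} (λ X′₁<p → X′₁≰p (ℕP.<⇒≤ X′₁<p))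
                       | BP.∧-zeroʳ (first P′ <ᵇ p)
                       | ℕP.*-zeroʳ (ι (first X′ <ᵇ x) + cornerCount X′) | ℕP.*-zeroʳ (ι (first P′ <ᵇ p) + cornerCount P′) = refl
...   | yes X′₁≤p rewrite ≤ᵇ-complete X′₁≤p | <ᵇ-complete (ℕP.≤-<-trans X′₁≤p p<x) | BP.∧-zeroʳ (first P′ <ᵇ p) with first X′ <? p
...     | yes X′₁<p rewrite <ᵇ-complete X′₁<p =
  commute-x≡1+p-X′₁<p (rook P′ X′) (ι (first P′ <ᵇ p)) (rook P′ (growFirst X′)) (lowerRookSum P′ X′) (downRookSum P′ X′) (cornerCount X′) (cornerCount P′) ih (rook-guarded p P′ X′ X′₁<p)
...     | no X′₁≮p rewrite ≮⇒<ᵇ-false X′₁≮p =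
  commute-x≡1+p-X′₁≡p (rook P′ X′) (ι (first P′ <ᵇ p)) (rook P′ (growFirst X′)) (lowerRookSum P′ X′) (downRookSum P′ X′) (cornerCount X′) (cornerCount P′) ih
    (rook-first-row-full p P′ X′ (ℕP.≤-antisym X′₁≤p (ℕP.≮⇒≥ X′₁≮p)) (All.head (proj₂ isP)) (first≥second (p ∷ P′) (proj₁ isP)))

rook-[]-size : ∀ Y → rookᵇ [] Y ≡ true → sum Y ≤ 1
rook-[]-size []      _ = z≤n
rook-[]-size (y ∷ Y) e = subst (λ t → y + t ≤ 1) (sym (restEmpty Y (∧-trueʳ {first Y ≤ᵇ 0} (∧-trueʳ {y ≤ᵇ 1} e)) (first≡0 {Y} (∧-trueʳ {y ≤ᵇ 1} e))))
  (subst (_≤ 1) (sym (ℕP.+-identityʳ y)) (≤ᵇ-sound y 1 (∧-trueˡ e)))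
  where
  first≡0 : ∀ {Y b} → ((first Y ≤ᵇ 0) ∧ b) ≡ true → first Y ≡ 0
  first≡0 {Y} e = ℕP.n≤0⇒n≡0 (≤ᵇ-sound (first Y) 0 (∧-trueˡ e))
  restEmpty : ∀ Y → rookᵇ [] Y ≡ true → first Y ≡ 0 → sum Y ≡ 0
  restEmpty []       _ _    = refl
  restEmpty (zero ∷ Y) e refl = restEmpty Y (∧-trueʳ {first Y ≤ᵇ 0} (∧-trueʳ {0 ≤ᵇ 1} e)) (first≡0 {Y} (∧-trueʳ {0 ≤ᵇ 1} e))

upRookSum-[] : ∀ X → IsPartition X → 1 ≤ sum X → upRookSum [] X ≡ 0
upRookSum-[] X isX 1≤X = sumMap-zero (rook []) (upCovers X) (All.map noRook (upCovers-sound X isX))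
  where
  noRook : ∀ {l} → IsPartition l × sum l ≡ suc (sum X) → rook [] l ≡ 0
  noRook {l} (_ , e) with rookᵇ [] l in r
  ... | false = refl
  ... | true  = ⊥-elim (ℕP.<-irrefl refl (ℕP.<-≤-trans (s≤s 1≤X) (subst (_≤ 1) e (rook-[]-size l r))))

rook-commutation : ∀ P X → IsPartition P → IsPartition X → RookCommutation P X
rook-commutation []       []                     _   _   = refl
rook-commutation (p ∷ P′) []                     isP _
  rewrite ℕP.*-zeroʳ (cornerCount (p ∷ P′)) | ℕP.+-identityʳ (upRookSum (p ∷ P′) [])
        | ℕP.+-identityʳ (downRookSum (p ∷ P′) []) | ℕP.+-identityʳ (downRookSum (p ∷ P′) []) =
  trans (ℕP.+-identityʳ _) (sym (trans (count-downCovers-∷ (λ l → rookᵇ l []) p P′)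
    (trans (cong (ι ((first P′ <ᵇ p) ∧ null (shrinkFirst p P′)) +_) (sumMap-zero _ (downCovers P′) (All.universal (λ _ → refl) _)))
           (trans (ℕP.+-identityʳ _) (removeLastBox p P′ isP)))))
  where
  removeLastBox : ∀ p P′ → IsPartition (p ∷ P′) → ι ((first P′ <ᵇ p) ∧ null (shrinkFirst p P′)) ≡ rook (p ∷ P′) (1 ∷ [])
  removeLastBox (suc zero)    []           _                = refl
  removeLastBox (suc zero)    (suc q ∷ P′) _                = refl
  removeLastBox (suc zero)    (zero ∷ P′)  (_ , _ ∷ () ∷ _)
  removeLastBox (suc (suc k)) P′           _                = cong ι (BP.∧-zeroʳ (first P′ <ᵇ suc (suc k)))
  removeLastBox zero          P′           (_ , () ∷ _)
rook-commutation []       (suc zero ∷ [])        _   _   = refl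
rook-commutation []       (suc zero ∷ suc y ∷ Y) _   isX =
  cong₂ _+_ (upRookSum-[] (1 ∷ suc y ∷ Y) isX (s≤s z≤n)) (ℕP.*-zeroʳ (cornerCount (1 ∷ suc y ∷ Y)))
rook-commutation []       (suc zero ∷ zero ∷ Y)  _   (_ , _ ∷ () ∷ _)
rook-commutation []       (suc (suc k) ∷ X′)     _   isX =
  cong₂ _+_ (upRookSum-[] (suc (suc k) ∷ X′) isX (s≤s z≤n)) (ℕP.*-zeroʳ (cornerCount (suc (suc k) ∷ X′)))
rook-commutation []       (zero ∷ X′)            _   (_ , () ∷ _)
rook-commutation (p ∷ P′) (x ∷ X′)               isP isX =
  rook-commutation-∷ p P′ x X′ isP isX
    (trans (cong (_+ cornerCount X′ * rook P′ X′) (sym (upRookSum-split P′ X′)))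
           (rook-commutation P′ X′ (IsPartition-rest (p ∷ P′) isP) (IsPartition-rest (x ∷ X′) isX)))

rookᵇ-refl : ∀ X → IsPartition X → rookᵇ X X ≡ true
rookᵇ-refl []      _   = refl
rookᵇ-refl (x ∷ X) isX rewrite ≤ᵇ-complete (ℕP.≤-refl {x}) | ≤ᵇ-complete (ℕP.n≤1+n x) | ≤ᵇ-complete (first≥second (x ∷ X) (proj₁ isX))
  = rookᵇ-refl X (IsPartition-rest (x ∷ X) isX)

a₂ᴸ+eqList≡rook : ∀ P Y → IsPartition P → IsPartition Y → a₂ᴸ P Y + ι (eqList P Y) ≡ rook P Y
a₂ᴸ+eqList≡rook P Y isP isY rewrite a₂ᴸ-rookᵇ P Y isP isY with eqList P Y in e
... | false = trans (ℕP.+-identityʳ _) (cong ι (BP.∧-identityʳ (rookᵇ P Y)))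
... | true rewrite eqList⇒≡ P Y e | rookᵇ-refl Y isY = refl

upA₂Sum : List ℕ → List ℕ → ℕ
upA₂Sum P X = sumMap (a₂ᴸ P) (upCovers X)

downA₂Sum : List ℕ → List ℕ → ℕ
downA₂Sum P X = sumMap (λ l → a₂ᴸ l X) (downCovers P)

upRookSum≡ : ∀ P X → IsPartition P → IsPartition X → upA₂Sum P X + occurrences P (upCovers X) ≡ upRookSum P X
upRookSum≡ P X isP isX = begin
  sumMap (a₂ᴸ P) (upCovers X) + sumMap (λ l → ι (eqList l P)) (upCovers X)
    ≡⟨ cong (sumMap (a₂ᴸ P) (upCovers X) +_) (sumMap-cong _ _ (upCovers X) (λ l → cong ι (eqList-sym l P))) ⟩
  sumMap (a₂ᴸ P) (upCovers X) + sumMap (λ l → ι (eqList P l)) (upCovers X)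
    ≡⟨ sumMap-+ (a₂ᴸ P) (λ l → ι (eqList P l)) (upCovers X) ⟨
  sumMap (λ l → a₂ᴸ P l + ι (eqList P l)) (upCovers X)
    ≡⟨ sumMap-congᴬ _ _ (upCovers X) (All.map (λ ok → a₂ᴸ+eqList≡rook P _ isP (proj₁ ok)) (upCovers-sound X isX)) ⟩
  upRookSum P X ∎
  where open ≡-Reasoning

downRookSum≡ : ∀ P X → IsPartition P → IsPartition X → downA₂Sum P X + occurrences X (downCovers P) ≡ downRookSum P X
downRookSum≡ P X isP isX = begin
  sumMap (λ l → a₂ᴸ l X) (downCovers P) + sumMap (λ l → ι (eqList l X)) (downCovers P)
    ≡⟨ sumMap-+ (λ l → a₂ᴸ l X) (λ l → ι (eqList l X)) (downCovers P) ⟨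
  sumMap (λ l → a₂ᴸ l X + ι (eqList l X)) (downCovers P)
    ≡⟨ sumMap-congᴬ _ _ (downCovers P) (All.map (λ ok → a₂ᴸ+eqList≡rook _ X (proj₁ ok) isX) (downCovers-sound P isP)) ⟩
  downRookSum P X ∎
  where open ≡-Reasoning

-- both sides count whether P covers X
covers-dual : ∀ P X → IsPartition P → IsPartition X → occurrences P (upCovers X) ≡ occurrences X (downCovers P)
covers-dual P X isP isX = trans (occurrences-upCovers X P isX isP) (sym (occurrences-downCovers X P isX isP))

loops-balance : ∀ P X → IsPartition P → IsPartition X →
  cornerCount X * a₂ᴸ P X + cornerCount P * rook P X ≡ cornerCount P * a₂ᴸ P X + cornerCount X * rook P X
loops-balance P X isP isX = balance (eqList P X) refl
  where
  balance : ∀ b → eqList P X ≡ b →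
            cornerCount X * a₂ᴸ P X + cornerCount P * rook P X ≡ cornerCount P * a₂ᴸ P X + cornerCount X * rook P X
  balance true  e rewrite eqList⇒≡ P X e = refl
  balance false e = trans (cong₂ (λ u v → cornerCount X * u + cornerCount P * v) a₂≡rook (sym a₂≡rook))
                          (ℕP.+-comm (cornerCount X * rook P X) (cornerCount P * a₂ᴸ P X))
    where
    a₂≡rook : a₂ᴸ P X ≡ rook P X
    a₂≡rook = trans (sym (ℕP.+-identityʳ _)) (trans (cong (a₂ᴸ P X +_) (sym (cong ι e))) (a₂ᴸ+eqList≡rook P X isP isX))

-- the coefficient of P in (D U − U D) X, compared with that in (D + I) X
local-commutation : ∀ P X → IsPartition P → IsPartition X →
  cornerCount X * a₂ᴸ P X + upA₂Sum P X ≡ cornerCount P * a₂ᴸ P X + downA₂Sum P X + a₂ᴸ P X + ι (eqList P X)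
local-commutation P X isP isX = ℕP.+-cancelʳ-≡ (κ + cX * r) _ _ (begin
  cX * a + Σu + (κ + cX * r)              ≡⟨ regroup₁ cX a Σu κ r ⟩
  cX * a + ((Σu + κ) + cX * r)            ≡⟨ cong (λ t → cX * a + (t + cX * r)) (upRookSum≡ P X isP isX) ⟩
  cX * a + (upRookSum P X + cX * r)      ≡⟨ cong (cX * a +_) (rook-commutation P X isP isX) ⟩
  cX * a + (downRookSum P X + cP * r + r) ≡⟨ regroup₂ cX a (downRookSum P X) cP r ⟩
  (cX * a + cP * r) + downRookSum P X + r ≡⟨ cong (λ t → t + downRookSum P X + r) (loops-balance P X isP isX) ⟩
  (cP * a + cX * r) + downRookSum P X + r ≡⟨ cong (λ t → (cP * a + cX * r) + t + r) (sym (downRookSum≡ P X isP isX)) ⟩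
  (cP * a + cX * r) + (Σd + κ′) + r       ≡⟨ cong (λ t → (cP * a + cX * r) + (Σd + t) + r) (sym (covers-dual P X isP isX)) ⟩
  (cP * a + cX * r) + (Σd + κ) + r        ≡⟨ cong (λ t → (cP * a + cX * r) + (Σd + κ) + t) (sym (a₂ᴸ+eqList≡rook P X isP isX)) ⟩
  (cP * a + cX * r) + (Σd + κ) + (a + e)  ≡⟨ regroup₃ cP a cX r Σd κ e ⟩
  cP * a + Σd + a + e + (κ + cX * r)      ∎)
  where
  open ≡-Reasoning
  cX = cornerCount X
  cP = cornerCount P
  a = a₂ᴸ P X
  r = rook P X
  e = ι (eqList P X)
  Σu = upA₂Sum P X
  Σd = downA₂Sum P X
  κ = occurrences P (upCovers X)
  κ′ = occurrences X (downCovers P)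
  regroup₁ : ∀ cX a Σu κ r → cX * a + Σu + (κ + cX * r) ≡ cX * a + ((Σu + κ) + cX * r)
  regroup₁ = ℕ-Solver.solve-∀
  regroup₂ : ∀ cX a R cP r → cX * a + (R + cP * r + r) ≡ (cX * a + cP * r) + R + r
  regroup₂ = ℕ-Solver.solve-∀
  regroup₃ : ∀ cP a cX r Σd κ e → (cP * a + cX * r) + (Σd + κ) + (a + e) ≡ cP * a + Σd + a + e + (κ + cX * r)
  regroup₃ = ℕ-Solver.solve-∀

count-++ : ∀ {A : Set} (p : A → Bool) xs ys → count p (xs ++ ys) ≡ count p xs + count p ys
count-++ p = sumMap-++ (λ x → ι (p x))

count-map : ∀ {A C : Set} (p : C → Bool) (f : A → C) xs → count p (map f xs) ≡ count (λ x → p (f x)) xs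
count-map p f = sumMap-map (λ x → ι (p x)) f

count-≡ᵇ-upTo : ∀ a n → count (a ≡ᵇ_) (upTo n) ≡ ι (a <ᵇ n)
count-≡ᵇ-upTo a zero    = refl
count-≡ᵇ-upTo a (suc n) = begin
  count (a ≡ᵇ_) (upTo (suc n))                  ≡⟨ cong (count (a ≡ᵇ_)) (sym (upTo-∷ʳ n)) ⟩
  count (a ≡ᵇ_) (upTo n ++ n ∷ [])              ≡⟨ count-++ (a ≡ᵇ_) (upTo n) (n ∷ []) ⟩
  count (a ≡ᵇ_) (upTo n) + (ι (a ≡ᵇ n) + 0)      ≡⟨ cong₂ _+_ (count-≡ᵇ-upTo a n) (ℕP.+-identityʳ _) ⟩
  ι (a <ᵇ n) + ι (a ≡ᵇ n)                       ≡⟨ <ᵇ-or-≡ᵇ a n ⟩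
  ι (a <ᵇ suc n)                                ∎
  where
  open ≡-Reasoning
  <ᵇ-or-≡ᵇ : ∀ a n → ι (a <ᵇ n) + ι (a ≡ᵇ n) ≡ ι (a <ᵇ suc n)
  <ᵇ-or-≡ᵇ zero    zero    = refl
  <ᵇ-or-≡ᵇ zero    (suc n) = refl
  <ᵇ-or-≡ᵇ (suc a) zero    = refl
  <ᵇ-or-≡ᵇ (suc a) (suc n) = <ᵇ-or-≡ᵇ a n

count-prepend-∷ : ∀ a P M ks → count (eqList (a ∷ P)) (concatMap (λ k → map (k ∷_) M) ks) ≡ count (a ≡ᵇ_) ks * count (eqList P) M
count-prepend-∷ a P M []       = refl
count-prepend-∷ a P M (k ∷ ks) = begin
  count (eqList (a ∷ P)) (map (k ∷_) M ++ concatMap (λ k → map (k ∷_) M) ks)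
    ≡⟨ count-++ (eqList (a ∷ P)) (map (k ∷_) M) _ ⟩
  count (eqList (a ∷ P)) (map (k ∷_) M) + count (eqList (a ∷ P)) (concatMap (λ k → map (k ∷_) M) ks)
    ≡⟨ cong₂ _+_ (trans (count-map (eqList (a ∷ P)) (k ∷_) M) (count-∧ˡ (a ≡ᵇ k) (eqList P) M)) (count-prepend-∷ a P M ks) ⟩
  ι (a ≡ᵇ k) * count (eqList P) M + count (a ≡ᵇ_) ks * count (eqList P) M
    ≡⟨ ℕP.*-distribʳ-+ (count (eqList P) M) (ι (a ≡ᵇ k)) (count (a ≡ᵇ_) ks) ⟨
  count (a ≡ᵇ_) (k ∷ ks) * count (eqList P) M ∎
  where open ≡-Reasoning

count-prepend-[] : ∀ M ks → count (eqList []) (concatMap (λ k → map (k ∷_) M) ks) ≡ 0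
count-prepend-[] M []       = refl
count-prepend-[] M (k ∷ ks) = trans (count-++ (eqList []) (map (k ∷_) M) _)
  (cong₂ _+_ (trans (count-map (eqList []) (k ∷_) M) (sumMap-zero _ M (All.universal (λ _ → refl) M))) (count-prepend-[] M ks))

count-listsUpTo : ∀ b L P → length P ≤ L → All (_≤ b) P → count (eqList P) (listsUpTo b L) ≡ 1
count-listsUpTo b zero    []      _         _          = refl
count-listsUpTo b (suc L) []      _         _          = cong suc (count-prepend-[] (listsUpTo b L) (upTo (suc b)))
count-listsUpTo b (suc L) (x ∷ P) (s≤s P≤L) (x≤b ∷ P≤b) = begin
  count (eqList (x ∷ P)) (concatMap (λ k → map (k ∷_) (listsUpTo b L)) (upTo (suc b)))
    ≡⟨ count-prepend-∷ x P (listsUpTo b L) (upTo (suc b)) ⟩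
  count (x ≡ᵇ_) (upTo (suc b)) * count (eqList P) (listsUpTo b L)
    ≡⟨ cong₂ _*_ (trans (count-≡ᵇ-upTo x (suc b)) (cong ι (<ᵇ-complete (s≤s x≤b)))) (count-listsUpTo b L P P≤L P≤b) ⟩
  1 ∎
  where open ≡-Reasoning

count-toPartition : ∀ P → IsPartition P → ∀ LL → count (λ y → eqList P (parts y)) (mapMaybe toPartition LL) ≡ count (eqList P) LL
count-toPartition P isP []        = refl
count-toPartition P isP (ks ∷ LL) with linked? _≥?_ ks | all? (1 ≤?_) ks
... | yes _      | yes _   = cong (ι (eqList P ks) +_) (count-toPartition P isP LL)
... | no ¬linked | _       = skip (λ P≡ks → ¬linked (subst (Linked _≥_) P≡ks (proj₁ isP)))
  where
  skip : ¬ P ≡ ks → count (λ y → eqList P (parts y)) (mapMaybe toPartition LL) ≡ ι (eqList P ks) + count (eqList P) LL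
  skip P≢ks rewrite ≢⇒eqList-false P ks P≢ks = count-toPartition P isP LL
... | yes _      | no ¬pos = skip (λ P≡ks → ¬pos (subst (All (1 ≤_)) P≡ks (proj₂ isP)))
  where
  skip : ¬ P ≡ ks → count (λ y → eqList P (parts y)) (mapMaybe toPartition LL) ≡ ι (eqList P ks) + count (eqList P) LL
  skip P≢ks rewrite ≢⇒eqList-false P ks P≢ks = count-toPartition P isP LL

count-filter-size : ∀ P N L → sum P ≤ N →
  count (λ y → eqList P (parts y)) (filter (λ y → size y ≤? N) L) ≡ count (λ y → eqList P (parts y)) L
count-filter-size P N []      P≤N = refl
count-filter-size P N (y ∷ L) P≤N with size y ≤ᵇ N in y≤N
... | true  = cong (ι (eqList P (parts y)) +_) (count-filter-size P N L P≤N)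
... | false rewrite ≢⇒eqList-false P (parts y) (λ P≡y → subst T y≤N (ℕP.≤⇒≤ᵇ (subst (λ Q → sum Q ≤ N) P≡y P≤N))) =
  count-filter-size P N L P≤N

count-partitionsUpTo : ∀ P N → IsPartition P → sum P ≤ N → count (λ y → eqList P (parts y)) (partitionsUpTo N) ≡ 1
count-partitionsUpTo P N isP P≤N = begin
  count (λ y → eqList P (parts y)) (partitionsUpTo N)
    ≡⟨ count-filter-size P N (mapMaybe toPartition (listsUpTo N N)) P≤N ⟩
  count (λ y → eqList P (parts y)) (mapMaybe toPartition (listsUpTo N N))
    ≡⟨ count-toPartition P isP (listsUpTo N N) ⟩
  count (eqList P) (listsUpTo N N)
    ≡⟨ count-listsUpTo N N P (ℕP.≤-trans (length≤sum P (proj₂ isP)) P≤N) (parts≤sum P N P≤N) ⟩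
  1 ∎
  where
  open ≡-Reasoning
  length≤sum : ∀ P → All (1 ≤_) P → length P ≤ sum P
  length≤sum []      []          = z≤n
  length≤sum (p ∷ P) (1≤p ∷ pos) = ℕP.+-mono-≤ 1≤p (length≤sum P pos)
  parts≤sum : ∀ P N → sum P ≤ N → All (_≤ N) P
  parts≤sum []      N _   = []
  parts≤sum (p ∷ P) N P≤N = ℕP.≤-trans (ℕP.m≤m+n p (sum P)) P≤N ∷ parts≤sum P N (ℕP.≤-trans (ℕP.m≤n+m (sum P) p) P≤N)

sumMap-select : ∀ P (F : List ℕ → ℕ) L →
  sumMap (λ y → ι (eqList P (parts y)) * F (parts y)) L ≡ F P * count (λ y → eqList P (parts y)) L
sumMap-select P F []      = sym (ℕP.*-zeroʳ (F P))
sumMap-select P F (y ∷ L) with eqList P (parts y) in e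
... | true  rewrite sym (eqList⇒≡ P (parts y) e) | sumMap-select P F L =
  trans (cong (_+ F P * count (λ y → eqList P (parts y)) L) (ℕP.+-identityʳ (F P))) (sym (ℕP.*-suc (F P) _))
... | false = sumMap-select P F L

sumMap-partitionsUpTo : ∀ N (F : List ℕ → ℕ) P → IsPartition P → (sum P ≤ N ⊎ F P ≡ 0) →
  sumMap (λ y → ι (eqList P (parts y)) * F (parts y)) (partitionsUpTo N) ≡ F P
sumMap-partitionsUpTo N F P isP (inj₁ P≤N) =
  trans (sumMap-select P F (partitionsUpTo N)) (trans (cong (F P *_) (count-partitionsUpTo P N isP P≤N)) (ℕP.*-identityʳ (F P)))
sumMap-partitionsUpTo N F P isP (inj₂ F≡0) =
  trans (sumMap-select P F (partitionsUpTo N)) (trans (cong (_* _) F≡0) (sym F≡0))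

sumMap-partitionsUpTo-occurrences : ∀ N (F : List ℕ → ℕ) L → All (λ l → IsPartition l × (sum l ≤ N ⊎ F l ≡ 0)) L →
  sumMap (λ y → count (λ l → eqList l (parts y)) L * F (parts y)) (partitionsUpTo N) ≡ sumMap F L
sumMap-partitionsUpTo-occurrences N F []      []                  = sumMap-zero _ (partitionsUpTo N) (All.universal (λ _ → refl) _)
sumMap-partitionsUpTo-occurrences N F (l ∷ L) ((isl , ok) ∷ oks) = begin
  sumMap (λ y → (ι (eqList l (parts y)) + count (λ l → eqList l (parts y)) L) * F (parts y)) E
    ≡⟨ sumMap-cong _ _ E (λ y → ℕP.*-distribʳ-+ (F (parts y)) (ι (eqList l (parts y))) _) ⟩
  sumMap (λ y → ι (eqList l (parts y)) * F (parts y) + count (λ l → eqList l (parts y)) L * F (parts y)) E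
    ≡⟨ sumMap-+ _ _ E ⟩
  sumMap (λ y → ι (eqList l (parts y)) * F (parts y)) E + sumMap (λ y → count (λ l → eqList l (parts y)) L * F (parts y)) E
    ≡⟨ cong₂ _+_ (sumMap-partitionsUpTo N F l isl ok) (sumMap-partitionsUpTo-occurrences N F L oks) ⟩
  F l + sumMap F L ∎
  where
  open ≡-Reasoning
  E = partitionsUpTo N

δ : Partition → Partition → ℤ
δ ρ x = ℤ.+ ι (samePartition ρ x)

pairing : (Partition → ℤ) → LinComb → ℤ
pairing F []            = ℤ.+ 0
pairing F ((c , x) ∷ v) = c *ℤ F x +ℤ pairing F v

coeff≡pairing : ∀ ρ v → coeff ρ v ≡ pairing (δ ρ) v
coeff≡pairing ρ []            = refl
coeff≡pairing ρ ((c , x) ∷ v) = cong₂ _+ℤ_ (select (samePartition ρ x)) (coeff≡pairing ρ v)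
  where
  select : ∀ b → (if b then c else ℤ.+ 0) ≡ c *ℤ ℤ.+ ι b
  select true  = sym (ℤP.*-identityʳ c)
  select false = sym (ℤP.*-zeroʳ c)

pairing-++ : ∀ F v w → pairing F (v ++ w) ≡ pairing F v +ℤ pairing F w
pairing-++ F []            w = sym (ℤP.+-identityˡ _)
pairing-++ F ((c , x) ∷ v) w = trans (cong (λ t → c *ℤ F x +ℤ t) (pairing-++ F v w)) (sym (ℤP.+-assoc (c *ℤ F x) (pairing F v) (pairing F w)))

pairing-⊖ : ∀ F v → pairing F (⊖ v) ≡ - pairing F v
pairing-⊖ F []            = refl
pairing-⊖ F ((c , x) ∷ v) = trans (cong₂ _+ℤ_ (sym (ℤP.neg-distribˡ-* c (F x))) (pairing-⊖ F v)) (sym (ℤP.neg-distrib-+ (c *ℤ F x) (pairing F v)))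

pairing-cong : ∀ F G v → (∀ x → F x ≡ G x) → pairing F v ≡ pairing G v
pairing-cong F G []            e = refl
pairing-cong F G ((c , x) ∷ v) e = cong₂ (λ a b → c *ℤ a +ℤ b) (e x) (pairing-cong F G v e)

pairing-+ : ∀ F G v → pairing (λ x → F x +ℤ G x) v ≡ pairing F v +ℤ pairing G v
pairing-+ F G []            = refl
pairing-+ F G ((c , x) ∷ v) = trans (cong (λ t → c *ℤ (F x +ℤ G x) +ℤ t) (pairing-+ F G v)) (distrib c (F x) (G x) (pairing F v) (pairing G v))
  where
  distrib : ∀ c a b r s → c *ℤ (a +ℤ b) +ℤ (r +ℤ s) ≡ (c *ℤ a +ℤ r) +ℤ (c *ℤ b +ℤ s)
  distrib = solve-∀

pairing-sub : ∀ F G v → pairing (λ x → F x +ℤ - G x) v ≡ pairing F v +ℤ - pairing G v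
pairing-sub F G v = trans (pairing-+ F (λ x → - G x) v) (cong (λ t → pairing F v +ℤ t) (neg v))
  where
  neg : ∀ v → pairing (λ x → - G x) v ≡ - pairing G v
  neg []            = refl
  neg ((c , x) ∷ v) = trans (cong₂ _+ℤ_ (sym (ℤP.neg-distribʳ-* c (G x))) (neg v)) (sym (ℤP.neg-distrib-+ (c *ℤ G x) (pairing G v)))

linExt-∷ : ∀ f c x v → linExt f ((c , x) ∷ v) ≡ linExt (λ _ → f x) ((c , x) ∷ []) ++ linExt f v
linExt-∷ f c x v = cong (_++ linExt f v) (sym (++-identityʳ _))

pairing-linExt : ∀ F f v → pairing F (linExt f v) ≡ pairing (λ x → pairing F (f x)) v
pairing-linExt F f []            = refl
pairing-linExt F f ((c , x) ∷ v) = begin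
  pairing F (linExt f ((c , x) ∷ v))
    ≡⟨ cong (pairing F) (linExt-∷ f c x v) ⟩
  pairing F (linExt (λ _ → f x) ((c , x) ∷ []) ++ linExt f v)
    ≡⟨ pairing-++ F (linExt (λ _ → f x) ((c , x) ∷ [])) (linExt f v) ⟩
  pairing F (linExt (λ _ → f x) ((c , x) ∷ [])) +ℤ pairing F (linExt f v)
    ≡⟨ cong₂ _+ℤ_ (scale (f x)) (pairing-linExt F f v) ⟩
  c *ℤ pairing F (f x) +ℤ pairing (λ x → pairing F (f x)) v ∎
  where
  open ≡-Reasoning
  scale : ∀ w → pairing F (linExt (λ _ → w) ((c , x) ∷ [])) ≡ c *ℤ pairing F w
  scale []            = sym (ℤP.*-zeroʳ c)
  scale ((d , y) ∷ w) = trans (cong₂ _+ℤ_ (ℤP.*-assoc c d (F y)) (scale w)) (sym (ℤP.*-distribˡ-+ c (d *ℤ F y) (pairing F w)))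

coeff-linExt : ∀ ρ f v → coeff ρ (linExt f v) ≡ pairing (λ x → coeff ρ (f x)) v
coeff-linExt ρ f v = trans (coeff≡pairing ρ (linExt f v))
  (trans (pairing-linExt (δ ρ) f v) (pairing-cong _ _ v (λ x → sym (coeff≡pairing ρ (f x)))))

pairing-map : ∀ (F h : Partition → ℕ) L → pairing (λ y → ℤ.+ F y) (map (λ y → (ℤ.+ h y , y)) L) ≡ ℤ.+ sumMap (λ y → h y * F y) L
pairing-map F h []      = refl
pairing-map F h (y ∷ L) = trans (cong₂ _+ℤ_ (sym (ℤP.pos-* (h y) (F y))) (pairing-map F h L)) (sym (ℤP.pos-+ (h y * F y) _))

enumerated-or-zero : ∀ N (F : List ℕ → ℕ) P → (¬ sum P ≤ N → F P ≡ 0) → sum P ≤ N ⊎ F P ≡ 0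
enumerated-or-zero N F P vanish with sum P ≤? N
... | yes P≤N = inj₁ P≤N
... | no  P≰N = inj₂ (vanish P≰N)

coeff-map : ∀ ρ (h : Partition → ℕ) L →
  coeff ρ (map (λ y → (ℤ.+ h y , y)) L) ≡ ℤ.+ sumMap (λ y → ι (samePartition ρ y) * h y) L
coeff-map ρ h L = trans (coeff≡pairing ρ (map (λ y → (ℤ.+ h y , y)) L))
  (trans (pairing-map (λ y → ι (samePartition ρ y)) h L) (cong ℤ.+_ (sumMap-cong _ _ L (λ y → ℕP.*-comm (h y) _))))

coeff-Dᵥ : ∀ ρ y → coeff ρ (Dᵥ y) ≡ ℤ.+ a₂ᴸ (parts ρ) (parts y)
coeff-Dᵥ ρ y = trans (coeff-map ρ (λ z → a₂ᴸ (parts z) (parts y)) (partitionsUpTo (suc (size y))))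
  (cong ℤ.+_ (sumMap-partitionsUpTo (suc (size y)) (λ Z → a₂ᴸ Z (parts y)) (parts ρ) (isPartition ρ)
    (enumerated-or-zero (suc (size y)) (λ Z → a₂ᴸ Z (parts y)) (parts ρ) (λ ρ≰ → a₂ᴸ-size (parts ρ) (parts y) (isPartition ρ) (isPartition y) (λ ρ≤y → ρ≰ (ℕP.m≤n⇒m≤1+n ρ≤y))))))

coeff-Uᵥ : ∀ ρ z → coeff ρ (Uᵥ z) ≡ ℤ.+ a₁ᴸ (parts z) (parts ρ)
coeff-Uᵥ ρ z = trans (coeff-map ρ (λ y → a₁ᴸ (parts z) (parts y)) (partitionsUpTo (suc (size z))))
  (cong ℤ.+_ (sumMap-partitionsUpTo (suc (size z)) (a₁ᴸ (parts z)) (parts ρ) (isPartition ρ)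
    (enumerated-or-zero (suc (size z)) (a₁ᴸ (parts z)) (parts ρ) (a₁ᴸ-size (parts z) (parts ρ) (isPartition z) (isPartition ρ)))))

sumMap-partitionsUpTo-weights : ∀ N (F : List ℕ → ℕ) c X L → IsPartition X → (sum X ≤ N ⊎ F X ≡ 0) →
  All (λ l → IsPartition l × (sum l ≤ N ⊎ F l ≡ 0)) L →
  sumMap (λ y → (occurrences (parts y) L + ι (eqList X (parts y)) * c) * F (parts y)) (partitionsUpTo N) ≡ c * F X + sumMap F L
sumMap-partitionsUpTo-weights N F c X L isX okX okL = begin
  sumMap (λ y → (occurrences (parts y) L + ι (eqList X (parts y)) * c) * F (parts y)) E
    ≡⟨ sumMap-cong _ _ E split ⟩
  sumMap (λ y → occurrences (parts y) L * F (parts y) + ι (eqList X (parts y)) * (c * F (parts y))) E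
    ≡⟨ sumMap-+ _ _ E ⟩
  sumMap (λ y → occurrences (parts y) L * F (parts y)) E + sumMap (λ y → ι (eqList X (parts y)) * (c * F (parts y))) E
    ≡⟨ cong₂ _+_ (sumMap-partitionsUpTo-occurrences N F L okL)
                  (sumMap-partitionsUpTo N (λ Y → c * F Y) X isX (map₂ (λ F≡0 → trans (cong (c *_) F≡0) (ℕP.*-zeroʳ c)) okX)) ⟩
  sumMap F L + c * F X
    ≡⟨ ℕP.+-comm (sumMap F L) (c * F X) ⟩
  c * F X + sumMap F L ∎
  where
  open ≡-Reasoning
  E = partitionsUpTo N
  split : ∀ y → (occurrences (parts y) L + ι (eqList X (parts y)) * c) * F (parts y)
              ≡ occurrences (parts y) L * F (parts y) + ι (eqList X (parts y)) * (c * F (parts y))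
  split y = trans (ℕP.*-distribʳ-+ (F (parts y)) (occurrences (parts y) L) (ι (eqList X (parts y)) * c)) (cong (occurrences (parts y) L * F (parts y) +_) (ℕP.*-assoc (ι (eqList X (parts y))) c _))

coeff-DUᵥ : ∀ ρ x → coeff ρ (D (Uᵥ x)) ≡ ℤ.+ (cornerCount (parts x) * a₂ᴸ (parts ρ) (parts x) + upA₂Sum (parts ρ) (parts x))
coeff-DUᵥ ρ x = begin
  coeff ρ (linExt Dᵥ (Uᵥ x))
    ≡⟨ coeff-linExt ρ Dᵥ (Uᵥ x) ⟩
  pairing (λ y → coeff ρ (Dᵥ y)) (Uᵥ x)
    ≡⟨ pairing-cong _ _ (Uᵥ x) (coeff-Dᵥ ρ) ⟩
  pairing (λ y → ℤ.+ a₂ᴸ P (parts y)) (Uᵥ x)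
    ≡⟨ pairing-map (λ y → a₂ᴸ P (parts y)) (a₁ x) E ⟩
  ℤ.+ sumMap (λ y → a₁ᴸ X (parts y) * a₂ᴸ P (parts y)) E
    ≡⟨ cong ℤ.+_ (sumMap-cong _ _ E (λ y → cong (_* a₂ᴸ P (parts y)) (a₁ᴸ-upCovers X (parts y) (isPartition x) (isPartition y)))) ⟩
  ℤ.+ sumMap (λ y → (occurrences (parts y) (upCovers X) + ι (eqList X (parts y)) * cornerCount X) * a₂ᴸ P (parts y)) E
    ≡⟨ cong ℤ.+_ (sumMap-partitionsUpTo-weights N (a₂ᴸ P) (cornerCount X) X (upCovers X) (isPartition x) (inj₁ (ℕP.n≤1+n _))
                 (All.map (λ { (isl , sl) → isl , inj₁ (ℕP.≤-reflexive sl) }) (upCovers-sound X (isPartition x)))) ⟩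
  ℤ.+ (cornerCount X * a₂ᴸ P X + upA₂Sum P X) ∎
  where
  open ≡-Reasoning
  P = parts ρ
  X = parts x
  N = suc (size x)
  E = partitionsUpTo N

coeff-UDᵥ : ∀ ρ x → coeff ρ (U (Dᵥ x)) ≡ ℤ.+ (cornerCount (parts ρ) * a₂ᴸ (parts ρ) (parts x) + downA₂Sum (parts ρ) (parts x))
coeff-UDᵥ ρ x = begin
  coeff ρ (linExt Uᵥ (Dᵥ x))
    ≡⟨ coeff-linExt ρ Uᵥ (Dᵥ x) ⟩
  pairing (λ z → coeff ρ (Uᵥ z)) (Dᵥ x)
    ≡⟨ pairing-cong _ _ (Dᵥ x) (coeff-Uᵥ ρ) ⟩
  pairing (λ z → ℤ.+ a₁ᴸ (parts z) P) (Dᵥ x)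
    ≡⟨ pairing-map (λ z → a₁ᴸ (parts z) P) (λ z → a₂ z x) E ⟩
  ℤ.+ sumMap (λ z → a₂ᴸ (parts z) X * a₁ᴸ (parts z) P) E
    ≡⟨ cong ℤ.+_ (sumMap-cong _ _ E (λ z → trans (ℕP.*-comm (a₂ᴸ (parts z) X) _)
                                              (cong (_* a₂ᴸ (parts z) X) (a₁ᴸ-downCovers (parts z) P (isPartition z) (isPartition ρ))))) ⟩
  ℤ.+ sumMap (λ z → (occurrences (parts z) (downCovers P) + ι (eqList P (parts z)) * cornerCount P) * a₂ᴸ (parts z) X) E
    ≡⟨ cong ℤ.+_ (sumMap-partitionsUpTo-weights N (λ Z → a₂ᴸ Z X) (cornerCount P) P (downCovers P) (isPartition ρ) (small P (isPartition ρ))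
                 (All.map (λ { (isl , _) → isl , small _ isl }) (downCovers-sound P (isPartition ρ)))) ⟩
  ℤ.+ (cornerCount P * a₂ᴸ P X + downA₂Sum P X) ∎
  where
  open ≡-Reasoning
  P = parts ρ
  X = parts x
  N = suc (size x)
  E = partitionsUpTo N
  small : ∀ Z → IsPartition Z → sum Z ≤ N ⊎ a₂ᴸ Z X ≡ 0
  small Z isZ = enumerated-or-zero N (λ Z → a₂ᴸ Z X) Z (λ Z≰ → a₂ᴸ-size Z X isZ (isPartition x) (λ Z≤X → Z≰ (ℕP.m≤n⇒m≤1+n Z≤X)))

vertex-commutation : ∀ ρ x → coeff ρ (D (Uᵥ x)) +ℤ - coeff ρ (U (Dᵥ x)) ≡ coeff ρ (Dᵥ x) +ℤ δ ρ x
vertex-commutation ρ x = begin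
  coeff ρ (D (Uᵥ x)) +ℤ - coeff ρ (U (Dᵥ x))
    ≡⟨ cong₂ (λ u w → u +ℤ - w) (coeff-DUᵥ ρ x) (coeff-UDᵥ ρ x) ⟩
  ℤ.+ (cornerCount X * a + upA₂Sum P X) +ℤ - ℤ.+ (cornerCount P * a + downA₂Sum P X)
    ≡⟨ cong (λ t → ℤ.+ t +ℤ - ℤ.+ (cornerCount P * a + downA₂Sum P X)) (local-commutation P X (isPartition ρ) (isPartition x)) ⟩
  ℤ.+ (cornerCount P * a + downA₂Sum P X + a + e) +ℤ - ℤ.+ (cornerCount P * a + downA₂Sum P X)
    ≡⟨ cong (_+ℤ - ℤ.+ (cornerCount P * a + downA₂Sum P X))
            (trans (ℤP.pos-+ (cornerCount P * a + downA₂Sum P X + a) e) (cong (_+ℤ ℤ.+ e) (ℤP.pos-+ (cornerCount P * a + downA₂Sum P X) a))) ⟩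
  (ℤ.+ (cornerCount P * a + downA₂Sum P X) +ℤ ℤ.+ a +ℤ ℤ.+ e) +ℤ - ℤ.+ (cornerCount P * a + downA₂Sum P X)
    ≡⟨ cancel (ℤ.+ (cornerCount P * a + downA₂Sum P X)) (ℤ.+ a) (ℤ.+ e) ⟩
  ℤ.+ a +ℤ ℤ.+ e
    ≡⟨ cong (_+ℤ ℤ.+ e) (sym (coeff-Dᵥ ρ x)) ⟩
  coeff ρ (Dᵥ x) +ℤ δ ρ x ∎
  where
  open ≡-Reasoning
  P = parts ρ
  X = parts x
  a = a₂ᴸ P X
  e = ι (eqList P X)
  cancel : ∀ u v w → (u +ℤ v +ℤ w) +ℤ - u ≡ v +ℤ w
  cancel = solve-∀

coeff-++ : ∀ ρ v w → coeff ρ (v ++ w) ≡ coeff ρ v +ℤ coeff ρ w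
coeff-++ ρ v w = trans (coeff≡pairing ρ (v ++ w))
  (trans (pairing-++ (δ ρ) v w) (sym (cong₂ _+ℤ_ (coeff≡pairing ρ v) (coeff≡pairing ρ w))))

coeff-⊖ : ∀ ρ v → coeff ρ (⊖ v) ≡ - coeff ρ v
coeff-⊖ ρ v = trans (coeff≡pairing ρ (⊖ v)) (trans (pairing-⊖ (δ ρ) v) (cong -_ (sym (coeff≡pairing ρ v))))

coeff-linExt-∘ : ∀ ρ f g v → coeff ρ (linExt g (linExt f v)) ≡ pairing (λ x → coeff ρ (linExt g (f x))) v
coeff-linExt-∘ ρ f g v = trans (coeff-linExt ρ g (linExt f v))
  (trans (pairing-linExt (λ y → coeff ρ (g y)) f v) (pairing-cong _ _ v (λ x → sym (coeff-linExt ρ g (f x)))))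

mainTheorem5 : ∀ (v : LinComb) → (D (U v) ⊕ (⊖ U (D v))) ≈ (D v ⊕ v)
mainTheorem5 v ρ = begin
  coeff ρ (D (U v) ++ ⊖ U (D v))
    ≡⟨ trans (coeff-++ ρ (D (U v)) (⊖ U (D v))) (cong (λ t → coeff ρ (D (U v)) +ℤ t) (coeff-⊖ ρ (U (D v)))) ⟩
  coeff ρ (D (U v)) +ℤ - coeff ρ (U (D v))
    ≡⟨ cong₂ (λ u w → u +ℤ - w) (coeff-linExt-∘ ρ Uᵥ Dᵥ v) (coeff-linExt-∘ ρ Dᵥ Uᵥ v) ⟩
  pairing (λ x → coeff ρ (D (Uᵥ x))) v +ℤ - pairing (λ x → coeff ρ (U (Dᵥ x))) v
    ≡⟨ pairing-sub _ _ v ⟨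
  pairing (λ x → coeff ρ (D (Uᵥ x)) +ℤ - coeff ρ (U (Dᵥ x))) v
    ≡⟨ pairing-cong _ _ v (vertex-commutation ρ) ⟩
  pairing (λ x → coeff ρ (Dᵥ x) +ℤ δ ρ x) v
    ≡⟨ pairing-+ _ _ v ⟩
  pairing (λ x → coeff ρ (Dᵥ x)) v +ℤ pairing (δ ρ) v
    ≡⟨ cong₂ _+ℤ_ (coeff-linExt ρ Dᵥ v) (coeff≡pairing ρ v) ⟨
  coeff ρ (D v) +ℤ coeff ρ v
    ≡⟨ coeff-++ ρ (D v) v ⟨
  coeff ρ (D v ++ v) ∎
  where open ≡-Reasoning
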